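{- Let $(X,x_0)$ be a pointed graph. (1) The functor $\mathsf{Fib}_{x_0}\colon\mathsf{Cov}(X)\to\mathsf{Set}$ is representable, represented by the universal cover $\tilde X_{x_0}\to X$; in particular, for every covering $Y\to X$, the hom-set $\mathsf{Cov}(X)(\tilde X_{x_0},Y)$ is in bijection with the fiber $\mathsf{Fib}_{x_0}(Y)$. (2) The fundamental group $A_1(X,x_0)$ is isomorphic to the automorphism group of $\mathsf{Fib}_{x_0}$ in the functor category $\mathsf{Set}^{\mathsf{Cov}(X)}$.
   Context: Graphs are simple undirected loopless graphs; graph maps send adjacent vertices to equal or adjacent vertices. $I_n$ has vertices $0,\dots,n$, edges $i\sim i+1$; a path of length $n$ is a graph map $\gamma\colon I_n\to X$; $\ast$ is concatenation. The path-homotopy class $[\gamma]$ of a path from $x$ to $x'$ is its path-component in the quotient of $\coprod_nP_nX(x,x')$ by reparametrization along surjective order-preserving graph maps $I_m\to I_n$ ($P_nX(x,x')$: paths of length $n$, adjacent iff distinct and pointwise equal-or-adjacent). $A_1(X,x_0)$ is the group of classes of loops at $x_0$ under concatenation. A graph map $p\colon Y\to X$ is a covering map if (i) for every vertex $y$, $p$ restricts to a bijection from $y$ together with its neighbours onto $p(y)$ together with its neighbours, and (ii) for all graph maps $u\colon I_3\to Y$, $v\colon I_1\square I_1\to X$ ($I_1\square I_1$ the $4$-cycle on $\{0,1\}^2$) with $p(u(0))=v(1,0)$, $p(u(1))=v(0,0)$, $p(u(2))=v(0,1)$, $p(u(3))=v(1,1)$, one has $u(0)=u(3)$ or $u(0)\sim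 u(3)$. $\mathsf{Cov}(X)$ has covering maps into $X$ as objects and graph maps over $X$ as morphisms. $\mathsf{Fib}_{x_0}$ sends $p\colon Y\to X$ to $p^{ -1}(x_0)$ and a morphism $f$ to its restriction $p^{ -1}(x_0)\to p'^{ -1}(x_0)$. The universal cover $\tilde X_{x_0}\to X$ is the graph whose vertices are the classes $[\gamma]$ of finite paths starting at $x_0$, with edges $[\gamma]\sim[\gamma\ast e]$ for $e$ a non-constant length-$1$ path starting at the endpoint of $\gamma$, mapping $[\gamma]$ to the endpoint of $\gamma$; it is a covering map and its fiber over $x_0$ is $A_1(X,x_0)$. -}

module Defs where

open import Level using (Level; _⊔_) renaming (zero to lzero; suc to lsuc)
open import Data.Nat as ℕ using (ℕ; zero; suc; _+_; _∸_; _<?_; s≤s; z≤n)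
open import Data.Nat.Properties as ℕP using (≤-refl; ≤-trans; <⇒≤; ≮⇒≥; ≤-antisym; m+n∸m≡n; n<1+n)
open import Data.Fin as Fin using (Fin; toℕ; fromℕ<; inject₁; fromℕ) renaming (zero to fz; suc to fs)
open import Data.Fin.Properties using (toℕ-inject₁; fromℕ<-toℕ; toℕ-fromℕ<; toℕ-fromℕ; toℕ<n; toℕ-injective; toℕ≤n; toℕ≤pred[n])
open import Data.Product using (Σ; _×_; _,_; proj₁; proj₂)
open import Data.Sum using (_⊎_; inj₁; inj₂)
open import Data.Empty using (⊥; ⊥-elim)
open import Relation.Nullary using (¬_; yes; no; contradiction)
open import Relation.Binary using (IsEquivalence; Setoid; Rel)
open import Relation.Binary.PropositionalEquality as P using (_≡_; refl)
open import Relation.Binary.Construct.Closure.Equivalence as EqC using (EqClosure)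
open import Function.Bundles using (Func; Inverse)
import Function.Construct.Composition as Comp
open import Algebra.Bundles.Raw using (RawMagma)

-- Constructively there are no quotient types, so a graph has a
-- vertex *setoid* (V, ≈) and an adjacency relation ∼ that is symmetric,
-- irreflexive (loopless) and respects ≈.  Graphs whose ≈ is _≡_ are the
-- ordinary simple graphs; setoid vertices are needed for the universal
-- cover, whose vertices are path-homotopy classes.

record Graph (ℓ : Level) : Set (lsuc ℓ) where
  infix 4 _≈_ _∼_ _≃_
  field
    V             : Set ℓ
    _≈_           : Rel V ℓ
    isEquivalence : IsEquivalence _≈_
    _∼_           : Rel V ℓ
    ∼-sym         : ∀ {x y} → x ∼ y → y ∼ x
    ∼-irrefl      : ∀ {x y} → x ∼ y → ¬ (x ≈ y)
    ∼-resp        : ∀ {x x' y y'} → x ≈ x' → y ≈ y' → x ∼ y → x' ∼ y'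
  open IsEquivalence isEquivalence public

  _≃_ : Rel V ℓ
  x ≃ y = x ≈ y ⊎ x ∼ y

  ≃-sym : ∀ {x y} → x ≃ y → y ≃ x
  ≃-sym (inj₁ e) = inj₁ (sym e)
  ≃-sym (inj₂ h) = inj₂ (∼-sym h)

  ≃-resp : ∀ {x x' y y'} → x ≈ x' → y ≈ y' → x ≃ y → x' ≃ y'
  ≃-resp e e' (inj₁ q) = inj₁ (trans (sym e) (trans q e'))
  ≃-resp e e' (inj₂ h) = inj₂ (∼-resp e e' h)

open Graph using (V)

record _⇒_ {a b} (X : Graph a) (Y : Graph b) : Set (a ⊔ b) where
  private
    module X = Graph X
    module Y = Graph Y
  field
    fun  : X.V → Y.V
    cong : ∀ {x y} → x X.≈ y → fun x Y.≈ fun y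
    adj  : ∀ {x y} → x X.∼ y → fun x Y.≃ fun y
open _⇒_ public

IAdj : (n : ℕ) → Rel (Fin (suc n)) lzero
IAdj n i j = (Σ (Fin n) λ k → inject₁ k ≡ i × fs k ≡ j)
           ⊎ (Σ (Fin n) λ k → inject₁ k ≡ j × fs k ≡ i)

private
  inj≢suc : ∀ {n} (k : Fin n) → inject₁ k ≡ fs k → ⊥
  inj≢suc k e = ℕP.1+n≢n (P.sym (P.trans (P.sym (toℕ-inject₁ k)) (P.cong toℕ e)))

I : ℕ → Graph lzero
I n = record
  { V = Fin (suc n) ; _≈_ = _≡_ ; isEquivalence = P.isEquivalence ; _∼_ = IAdj n
  ; ∼-sym = λ { (inj₁ p) → inj₂ p ; (inj₂ p) → inj₁ p }
  ; ∼-irrefl = λ { (inj₁ (k , refl , refl)) e → inj≢suc k e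
                 ; (inj₂ (k , refl , refl)) e → inj≢suc k (P.sym e) }
  ; ∼-resp = λ { refl refl h → h } }

-- Box product of graphs; I₁ □ I₁ is the 4-cycle on {0,1}².
_□_ : ∀ {a b} → Graph a → Graph b → Graph (a ⊔ b)
X □ Y = record
  { V = X.V × Y.V
  ; _≈_ = λ p q → proj₁ p X.≈ proj₁ q × proj₂ p Y.≈ proj₂ q
  ; isEquivalence = record
      { refl = X.refl , Y.refl
      ; sym = λ { (e , f) → X.sym e , Y.sym f }
      ; trans = λ { (e , f) (e' , f') → X.trans e e' , Y.trans f f' } }
  ; _∼_ = λ p q → (proj₁ p X.∼ proj₁ q × proj₂ p Y.≈ proj₂ q)
                ⊎ (proj₁ p X.≈ proj₁ q × proj₂ p Y.∼ proj₂ q)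
  ; ∼-sym = λ { (inj₁ (h , e)) → inj₁ (X.∼-sym h , Y.sym e)
              ; (inj₂ (e , h)) → inj₂ (X.sym e , Y.∼-sym h) }
  ; ∼-irrefl = λ { (inj₁ (h , _)) (e , _) → X.∼-irrefl h e
                 ; (inj₂ (_ , h)) (_ , e) → Y.∼-irrefl h e }
  ; ∼-resp = λ { (e₁ , f₁) (e₂ , f₂) (inj₁ (h , f)) →
                     inj₁ (X.∼-resp e₁ e₂ h , Y.trans (Y.sym f₁) (Y.trans f f₂))
               ; (e₁ , f₁) (e₂ , f₂) (inj₂ (e , h)) →
                     inj₂ (X.trans (X.sym e₁) (X.trans e e₂) , Y.∼-resp f₁ f₂ h) } }
  where
    module X = Graph X
    module Y = Graph Y

Square : Graph lzero
Square = I 1 □ I 1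

module Paths {ℓ} (X : Graph ℓ) where
  open Graph X hiding (V) renaming (refl to ≈-refl; sym to ≈-sym; trans to ≈-trans)

  Walk : Set ℓ
  Walk = Σ ℕ λ n → I n ⇒ X

  len : Walk → ℕ
  len = proj₁

  start end : Walk → V X
  start (n , γ) = fun γ fz
  end   (n , γ) = fun γ (fromℕ n)

  _≤F_ : ∀ {n} → Fin n → Fin n → Set
  i ≤F j = toℕ i ℕ.≤ toℕ j

  data Step : Walk → Walk → Set ℓ where
    reparam  : ∀ {m n} (γ : I n ⇒ X) (δ : I m ⇒ X) (r : I m ⇒ I n)
             → (∀ j → Σ (Fin (suc m)) λ i → fun r i ≡ j)
             → (∀ {i j} → i ≤F j → fun r i ≤F fun r j)
             → (∀ i → fun δ i ≈ fun γ (fun r i))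
             → Step (n , γ) (m , δ)
    adjacent : ∀ {n} (γ δ : I n ⇒ X)
             → fun γ fz ≈ fun δ fz → fun γ (fromℕ n) ≈ fun δ (fromℕ n)
             → (∀ i → fun γ i ≃ fun δ i)
             → Step (n , γ) (n , δ)

  -- Two paths are homotopic iff they lie in the same path-component of the
  -- quotient of ∐ₙ Pₙ X(x,x') by reparametrisation, i.e. they are related
  -- by the equivalence relation generated by Step.
  Homotopic : Rel Walk ℓ
  Homotopic = EqClosure Step

  private
    ext : ∀ {n} → I n ⇒ X → ℕ → V X
    ext {n} γ k with k <? suc n
    ... | yes p = fun γ (fromℕ< p)
    ... | no _  = fun γ (fromℕ n)

    ext-at : ∀ {n} (γ : I n ⇒ X) k (p : k ℕ.< suc n) → ext γ k ≈ fun γ (fromℕ< p)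
    ext-at {n} γ k p with k <? suc n
    ... | yes q = cong γ (toℕ-injective (P.trans (toℕ-fromℕ< q) (P.sym (toℕ-fromℕ< p))))
    ... | no ¬q = contradiction p ¬q

    ext-toℕ : ∀ {n} (γ : I n ⇒ X) (i : Fin (suc n)) → ext γ (toℕ i) ≈ fun γ i
    ext-toℕ γ i = ≈-trans (ext-at γ (toℕ i) (toℕ<n i)) (cong γ (fromℕ<-toℕ i (toℕ<n i)))

    ext-end : ∀ {n} (γ : I n ⇒ X) → ext γ n ≈ fun γ (fromℕ n)
    ext-end {n} γ = P.subst (λ k → ext γ k ≈ fun γ (fromℕ n)) (toℕ-fromℕ n) (ext-toℕ γ (fromℕ n))

    ext-step : ∀ {n} (γ : I n ⇒ X) k → k ℕ.< n → ext γ k ≃ ext γ (suc k)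
    ext-step {n} γ k k<n =
      ≃-resp (≈-sym (ext-at γ k (ℕP.m<n⇒m<1+n k<n))) (≈-sym (ext-at γ (suc k) (s≤s k<n)))
        (adj γ (inj₁ (fromℕ< k<n , toℕ-injective e , refl)))
      where
        e : toℕ (inject₁ (fromℕ< k<n)) ≡ toℕ (fromℕ< (ℕP.m<n⇒m<1+n k<n))
        e = P.trans (toℕ-inject₁ _) (P.trans (toℕ-fromℕ< k<n) (P.sym (toℕ-fromℕ< _)))

    suc-∸ : ∀ k n → n ℕ.≤ k → suc k ∸ n ≡ suc (k ∸ n)
    suc-∸ k zero z≤n = refl
    suc-∸ (suc k) (suc n) (s≤s le) = suc-∸ k n le

  mkPath : (N : ℕ) (F : ℕ → V X) → (∀ k → k ℕ.< N → F k ≃ F (suc k)) → I N ⇒ X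
  mkPath N F st = record
    { fun = λ i → F (toℕ i)
    ; cong = λ { refl → ≈-refl }
    ; adj = λ { (inj₁ (k , refl , refl)) → P.subst (λ t → F t ≃ F (suc (toℕ k)))
                                              (P.sym (toℕ-inject₁ k)) (st (toℕ k) (toℕ<n k))
              ; (inj₂ (k , refl , refl)) → ≃-sym (P.subst (λ t → F t ≃ F (suc (toℕ k)))
                                              (P.sym (toℕ-inject₁ k)) (st (toℕ k) (toℕ<n k))) } }

  private
   module Concat {n m} (γ : I n ⇒ X) (δ : I m ⇒ X) (e : fun γ (fromℕ n) ≈ fun δ fz) where
      F : ℕ → V X
      F k with k <? n
      ... | yes _ = ext γ k
      ... | no _  = ext δ (k ∸ n)

      junction : ext γ n ≈ ext δ 0
      junction = ≈-trans (ext-end γ) (≈-trans e (≈-sym (ext-toℕ δ fz)))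

      st : ∀ k → k ℕ.< n + m → F k ≃ F (suc k)
      st k k< with k <? n | suc k <? n
      ... | yes p | yes q = ext-step γ k p
      ... | yes p | no ¬q = ≃-resp ≈-refl (jn (≤-antisym p (≮⇒≥ ¬q))) (ext-step γ k p)
        where
          jn : suc k ≡ n → ext γ (suc k) ≈ ext δ (suc k ∸ n)
          jn e = P.subst (λ t → ext γ t ≈ ext δ (t ∸ n)) (P.sym e)
                   (P.subst (λ t → ext γ n ≈ ext δ t) (P.sym (ℕP.n∸n≡0 n)) junction)
      ... | no ¬p | yes q = contradiction (<⇒≤ q) ¬p
      ... | no ¬p | no ¬q = P.subst (λ t → ext δ (k ∸ n) ≃ ext δ t) (P.sym (suc-∸ k n (≮⇒≥ ¬p)))
                              (ext-step δ (k ∸ n) (P.subst (ℕ._≤ m) (suc-∸ k n (≮⇒≥ ¬p)) (ℕP.m≤n+o⇒m∸n≤o (suc k) n k<)))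

      path : I (n + m) ⇒ X
      path = mkPath (n + m) F st

      F-far : ∀ k → ¬ (k ℕ.< n) → F k ≡ ext δ (k ∸ n)
      F-far k ¬p with k <? n
      ... | yes p = contradiction p ¬p
      ... | no _  = P.refl

      path-end : fun path (fromℕ (n + m)) ≈ fun δ (fromℕ m)
      path-end = P.subst (λ t → F t ≈ fun δ (fromℕ m)) (P.sym (toℕ-fromℕ (n + m)))
        (P.subst (_≈ fun δ (fromℕ m)) (P.sym (F-far (n + m) (ℕP.m+n≮m n m)))
          (P.subst (λ t → ext δ t ≈ fun δ (fromℕ m)) (P.sym (m+n∸m≡n n m)) (ext-end δ)))

      path-start : fun path fz ≈ fun γ fz
      path-start with 0 <? n
      ... | yes _ = ext-toℕ γ fz
      ... | no ¬p = ≈-trans (P.subst (λ t → ext δ (0 ∸ n) ≈ ext δ t) (ℕP.0∸n≡0 n) ≈-refl) (≈-trans (≈-sym (ext-toℕ δ fz)) (≈-trans (≈-sym e) (≈-trans (≈-sym (ext-end γ))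
                      (≈-trans (P.subst (λ t → ext γ t ≈ ext γ 0) (P.sym n≡0) ≈-refl) (ext-toℕ γ fz)))))
        where
          n≡0 : n ≡ 0
          n≡0 = ℕP.n≤0⇒n≡0 (≮⇒≥ ¬p)

  concat : (γ δ : Walk) → end γ ≈ start δ → Walk
  concat (n , γ) (m , δ) e = n + m , Concat.path γ δ e

  start-concat : ∀ γ δ e → start (concat γ δ e) ≈ start γ
  start-concat (n , γ) (m , δ) e = Concat.path-start γ δ e

  end-concat : ∀ γ δ e → end (concat γ δ e) ≈ end δ
  end-concat (n , γ) (m , δ) e = Concat.path-end γ δ e

  edge : ∀ {u v} → u ∼ v → Walk
  edge {u} {v} h = 1 , mkPath 1 F (λ { zero _ → inj₂ h ; (suc _) (s≤s ()) })
    where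
      F : ℕ → V X
      F zero    = u
      F (suc _) = v

  private
    r-end : ∀ {m n} (r : I m ⇒ I n)
          → (∀ j → Σ (Fin (suc m)) λ i → fun r i ≡ j)
          → (∀ {i j} → i ≤F j → fun r i ≤F fun r j)
          → fun r (fromℕ m) ≡ fromℕ n
    r-end {m} {n} r surj mono with surj (fromℕ n)
    ... | i , ri≡ = toℕ-injective (P.trans (≤-antisym (toℕ≤pred[n] (fun r (fromℕ m))) n≤) (P.sym (toℕ-fromℕ n)))
      where
        i≤ : i ≤F fromℕ m
        i≤ = P.subst (toℕ i ℕ.≤_) (P.sym (toℕ-fromℕ m)) (toℕ≤pred[n] i)
        n≤ : n ℕ.≤ toℕ (fun r (fromℕ m))
        n≤ = P.subst (ℕ._≤ toℕ (fun r (fromℕ m))) (P.trans (P.cong toℕ ri≡) (toℕ-fromℕ n)) (mono i≤)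

    step-end : ∀ {γ δ} → Step γ δ → end γ ≈ end δ
    step-end (reparam {m} {n} γ δ r surj mono eq) =
      ≈-sym (P.subst (λ t → fun δ (fromℕ m) ≈ fun γ t) (r-end r surj mono) (eq (fromℕ m)))
    step-end (adjacent γ δ _ e _) = e

  end-hom : ∀ {γ δ} → Homotopic γ δ → end γ ≈ end δ
  end-hom = EqC.gfold isEquivalence end step-end

module _ {ℓ} (X : Graph ℓ) (x₀ : V X) where
  open Graph X hiding (V) renaming (refl to ≈-refl; sym to ≈-sym; trans to ≈-trans)
  open Paths X

  Loop : Set ℓ
  Loop = Σ Walk λ γ → start γ ≈ x₀ × end γ ≈ x₀

  _·L_ : Loop → Loop → Loop
  (γ , s , t) ·L (δ , s' , t') =
    concat γ δ j , ≈-trans (start-concat γ δ j) s , ≈-trans (end-concat γ δ j) t'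
    where j = ≈-trans t (≈-sym s')

  A₁ : RawMagma ℓ ℓ
  A₁ = record
    { Carrier = Loop
    ; _≈_     = λ a b → Homotopic (proj₁ a) (proj₁ b)
    ; _∙_     = _·L_ }

-- Edges: [γ] ∼ [γ ∗ e] for e a
-- non-constant length-1 path starting at the end of γ (in either
-- direction), i.e. classes A, B are adjacent iff some representative γ
-- of A and some such e have γ ∗ e ∈ B (or symmetrically).

module UniversalCover {ℓ} (X : Graph ℓ) (x₀ : V X) where
  open Graph X hiding (V) renaming (refl to ≈-refl; sym to ≈-sym; trans to ≈-trans)
  open Paths X

  UVert : Set ℓ
  UVert = Σ Walk λ γ → start γ ≈ x₀

  _≈U_ : Rel UVert ℓ
  a ≈U b = Homotopic (proj₁ a) (proj₁ b)

  Arrow : Rel UVert ℓ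
  Arrow a b = Σ UVert λ c → Σ (V X) λ v → Σ (end (proj₁ c) ∼ v) λ h →
              (proj₁ a ≡H proj₁ c) × (concat (proj₁ c) (edge h) ≈-refl ≡H proj₁ b)
    where _≡H_ = Homotopic

  private
    module HE = IsEquivalence (EqC.isEquivalence Step)

    arrow-resp : ∀ {a a' b b'} → a ≈U a' → b ≈U b' → Arrow a b → Arrow a' b'
    arrow-resp e e' (c , v , h , p , q) = c , v , h , HE.trans (HE.sym e) p , HE.trans q e'

    arrow-irrefl : ∀ {a b} → Arrow a b → ¬ (a ≈U b)
    arrow-irrefl {a} {b} (c , v , h , p , q) e =
      ∼-irrefl h (≈-sym (≈-trans (≈-sym (end-concat (proj₁ c) (edge h) ≈-refl))
                     (≈-trans (end-hom q) (≈-trans (≈-sym (end-hom e)) (end-hom p)))))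

  UC : Graph ℓ
  UC = record
    { V = UVert
    ; _≈_ = _≈U_
    ; isEquivalence = record { refl = HE.refl ; sym = HE.sym ; trans = HE.trans }
    ; _∼_ = λ a b → Arrow a b ⊎ Arrow b a
    ; ∼-sym = λ { (inj₁ x) → inj₂ x ; (inj₂ x) → inj₁ x }
    ; ∼-irrefl = λ {a} {b} → λ { (inj₁ x) e → arrow-irrefl {a} {b} x e
                               ; (inj₂ x) e → arrow-irrefl {b} {a} x (HE.sym e) }
    ; ∼-resp = λ {a} {a'} {b} {b'} → λ { e e' (inj₁ x) → inj₁ (arrow-resp {a} {a'} {b} {b'} e e' x)
                                       ; e e' (inj₂ x) → inj₂ (arrow-resp {b} {b'} {a} {a'} e' e x) } }

  private
    arrow-end : ∀ {a b} → Arrow a b → end (proj₁ a) ∼ end (proj₁ b)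
    arrow-end (c , v , h , p , q) =
      ∼-resp (≈-sym (end-hom p)) (≈-trans (≈-sym (end-concat (proj₁ c) (edge h) ≈-refl)) (end-hom q)) h

  proj : UC ⇒ X
  proj = record
    { fun  = λ a → end (proj₁ a)
    ; cong = λ {a} {b} → end-hom {proj₁ a} {proj₁ b}
    ; adj  = λ {a} {b} → λ { (inj₁ x) → inj₂ (arrow-end {a} {b} x)
                           ; (inj₂ x) → inj₂ (∼-sym (arrow-end {b} {a} x)) } }

module _ {ℓ ℓ'} {Y : Graph ℓ'} {X : Graph ℓ} where
  private
    module X = Graph X
    module Y = Graph Y

  record IsCovering (p : Y ⇒ X) : Set (ℓ ⊔ ℓ') where
    field
      -- (i) p restricts to a bijection N[y] → N[p y] of closed neighbourhoods
      nbhd-injective  : ∀ y {z z'} → y Y.≃ z → y Y.≃ z' → fun p z X.≈ fun p z' → z Y.≈ z'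
      nbhd-surjective : ∀ y {w} → fun p y X.≃ w → Σ Y.V λ z → y Y.≃ z × fun p z X.≈ w
      square : (u : I 3 ⇒ Y) (v : Square ⇒ X)
             → fun p (fun u fz)                   X.≈ fun v (fs fz , fz)
             → fun p (fun u (fs fz))              X.≈ fun v (fz , fz)
             → fun p (fun u (fs (fs fz)))         X.≈ fun v (fz , fs fz)
             → fun p (fun u (fs (fs (fs fz))))    X.≈ fun v (fs fz , fs fz)
             → fun u fz Y.≃ fun u (fs (fs (fs fz)))

module CovCat {ℓ} (X : Graph ℓ) (x₀ : V X) where
  private
    module X = Graph X

  record Over : Set (lsuc ℓ) where
    field
      G : Graph ℓ
      p : G ⇒ X

  record Cover : Set (lsuc ℓ) where
    field
      G          : Graph ℓ
      p          : G ⇒ X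
      isCovering : IsCovering p
    over : Over
    over = record { G = G ; p = p }

  open Over

  record Mor (A B : Over) : Set ℓ where
    field
      map  : G A ⇒ G B
      comm : ∀ y → fun (p B) (fun map y) X.≈ fun (p A) y
  open Mor public

  _∘M_ : ∀ {A B C} → Mor B C → Mor A B → Mor A C
  _∘M_ {A} {B} {C} f g = record
    { map  = record { fun  = λ y → fun (map f) (fun (map g) y)
                    ; cong = λ e → cong (map f) (cong (map g) e)
                    ; adj  = λ h → adjlem (adj (map g) h) }
    ; comm = λ y → X.trans (comm f (fun (map g) y)) (comm g y) }
    where
      module B = Graph (G B)
      adjlem : ∀ {x y} → x B.≃ y → Graph._≃_ (G C) (fun (map f) x) (fun (map f) y)
      adjlem (inj₁ e) = inj₁ (cong (map f) e)
      adjlem (inj₂ h) = adj (map f) h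

  Hom : Over → Over → Setoid ℓ ℓ
  Hom A B = record
    { Carrier = Mor A B
    ; _≈_ = λ f g → ∀ y → fun (map f) y B.≈ fun (map g) y
    ; isEquivalence = record { refl = λ y → B.refl ; sym = λ e y → B.sym (e y)
                             ; trans = λ e e' y → B.trans (e y) (e' y) } }
    where module B = Graph (G B)

  Fib : Over → Setoid ℓ ℓ
  Fib A = record
    { Carrier = Σ (V (G A)) λ y → fun (p A) y X.≈ x₀
    ; _≈_ = λ a b → proj₁ a A.≈ proj₁ b
    ; isEquivalence = record { refl = A.refl ; sym = A.sym ; trans = A.trans } }
    where module A = Graph (G A)

  fibMap : ∀ {A B} → Mor A B → Func (Fib A) (Fib B)
  fibMap f = record
    { to   = λ { (y , e) → fun (map f) y , X.trans (comm f y) e }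
    ; cong = cong (map f) }

  Represents : Over → Set (lsuc ℓ)
  Represents U =
    Σ ((Y : Cover) → Inverse (Hom U (Cover.over Y)) (Fib (Cover.over Y))) λ Φ →
      ∀ {Y Y' : Cover} (f : Mor (Cover.over Y) (Cover.over Y')) (g : Mor U (Cover.over Y)) →
        Setoid._≈_ (Fib (Cover.over Y'))
          (Inverse.to (Φ Y') (f ∘M g)) (Func.to (fibMap f) (Inverse.to (Φ Y) g))

  record FibAut : Set (lsuc ℓ) where
    field
      component : (Y : Cover) → Inverse (Fib (Cover.over Y)) (Fib (Cover.over Y))
      natural   : ∀ {Y Y' : Cover} (f : Mor (Cover.over Y) (Cover.over Y')) y →
                  Setoid._≈_ (Fib (Cover.over Y'))
                    (Inverse.to (component Y') (Func.to (fibMap f) y))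
                    (Func.to (fibMap f) (Inverse.to (component Y) y))
  open FibAut

  _·A_ : FibAut → FibAut → FibAut
  α ·A β = record
    { component = λ Y → Comp.inverse (component β Y) (component α Y)
    ; natural = λ {Y} {Y'} f y →
        Setoid.trans (Fib (Cover.over Y'))
          {Inverse.to (component α Y') (Inverse.to (component β Y') (Func.to (fibMap f) y))}
          {Inverse.to (component α Y') (Func.to (fibMap f) (Inverse.to (component β Y) y))}
          {Func.to (fibMap f) (Inverse.to (component α Y) (Inverse.to (component β Y) y))}
          (Inverse.to-cong (component α Y')
             {Inverse.to (component β Y') (Func.to (fibMap f) y)}
             {Func.to (fibMap f) (Inverse.to (component β Y) y)}
             (natural β {Y} {Y'} f y))
          (natural α {Y} {Y'} f (Inverse.to (component β Y) y)) }

  AutFib : RawMagma (lsuc ℓ) (lsuc ℓ)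
  AutFib = record
    { Carrier = FibAut
    ; _≈_ = λ α β → ∀ (Y : Cover) y →
              Setoid._≈_ (Fib (Cover.over Y)) (Inverse.to (component α Y) y) (Inverse.to (component β Y) y)
    ; _∙_ = _·A_ }

  universal : Over
  universal = record { G = UniversalCover.UC X x₀ ; p = UniversalCover.proj X x₀ }

-- Walks lift uniquely along a covering, one step at a time, by the bijection on closed neighbourhoods;
-- the end of the lift depends only on the homotopy class of the walk, because pointwise adjacent walks
-- lift to pointwise adjacent walks by the square condition. So a point y over x₀ gives a morphism
-- X̃ → Y, [γ] ↦ end of the lift of γ at y, and every morphism out of X̃ is of this form with y the image
-- of the constant walk: this is representability. A loop g acts on every fibre by transport along its
-- reverse; this is natural, and by naturality along the morphisms X̃ → Y every automorphism of Fib is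
-- determined by where it sends the basepoint of X̃, i.e. by a loop. That X̃ is itself a covering comes
-- from the description of the neighbours of [γ] as the classes of γ extended by one vertex.

module Submission where

open import Defs
open import Data.Product using (Σ; _×_; _,_; proj₁; proj₂)
open import Algebra.Morphism.Structures using (module MagmaMorphisms)
open import Data.Nat using (ℕ; zero; suc; _+_; _∸_; _<?_; _≤?_; s≤s; z≤n; _≤_; _<_)
import Data.Nat.Properties as ℕP
open import Data.Fin using (Fin; toℕ; fromℕ<; inject₁; fromℕ) renaming (zero to fz; suc to fs)
import Data.Fin.Properties as FP
open import Data.Sum as Sum using (_⊎_; inj₁; inj₂)
open import Data.Empty using (⊥-elim)
open import Relation.Nullary using (¬_; yes; no)
open import Relation.Binary using (IsEquivalence; Setoid; Rel)
open import Relation.Binary.PropositionalEquality as P using (_≡_; refl)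
import Relation.Binary.Construct.Closure.Equivalence as EqC
open import Function.Bundles using (Func; Inverse)

≤-suc-cases : ∀ {k n} → k ≤ suc n → k ≤ n ⊎ k ≡ suc n
≤-suc-cases le = Sum.map₁ ℕP.≤-pred (ℕP.m≤n⇒m<n∨m≡n le)

IAdj-toℕ : ∀ {n} {i j : Fin (suc n)} → IAdj n i j → toℕ j ≡ suc (toℕ i) ⊎ toℕ i ≡ suc (toℕ j)
IAdj-toℕ (inj₁ (k , refl , refl)) = inj₁ (P.cong suc (P.sym (FP.toℕ-inject₁ k)))
IAdj-toℕ (inj₂ (k , refl , refl)) = inj₂ (P.cong suc (P.sym (FP.toℕ-inject₁ k)))

clamp : ∀ n → ℕ → Fin (suc n)
clamp n k with k <? suc n
... | yes p = fromℕ< p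
... | no _ = fromℕ n

toℕ-clamp : ∀ n k → k ≤ n → toℕ (clamp n k) ≡ k
toℕ-clamp n k le with k <? suc n
... | yes p = FP.toℕ-fromℕ< p
... | no ¬p = ⊥-elim (¬p (s≤s le))

clamp-toℕ : ∀ n (i : Fin (suc n)) → clamp n (toℕ i) ≡ i
clamp-toℕ n i = FP.toℕ-injective (toℕ-clamp n (toℕ i) (FP.toℕ≤pred[n] i))

clamp-ge : ∀ n k → n ≤ k → clamp n k ≡ fromℕ n
clamp-ge n k le with k <? suc n
... | yes p = FP.toℕ-injective (P.trans (FP.toℕ-fromℕ< p) (P.trans (ℕP.≤-antisym (ℕP.≤-pred p) le) (P.sym (FP.toℕ-fromℕ n))))
... | no _ = refl

clamp-adj : ∀ n k → k < n → IAdj n (clamp n k) (clamp n (suc k))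
clamp-adj n k lt = inj₁ (fromℕ< lt , FP.toℕ-injective e1 , FP.toℕ-injective e2)
  where
    e1 : toℕ (inject₁ (fromℕ< lt)) ≡ toℕ (clamp n k)
    e1 = P.trans (FP.toℕ-inject₁ _) (P.trans (FP.toℕ-fromℕ< lt) (P.sym (toℕ-clamp n k (ℕP.<⇒≤ lt))))
    e2 : toℕ (fs (fromℕ< lt)) ≡ toℕ (clamp n (suc k))
    e2 = P.trans (P.cong suc (FP.toℕ-fromℕ< lt)) (P.sym (toℕ-clamp n (suc k) lt))

clamp-0 : ∀ n → clamp n 0 ≡ fz
clamp-0 n = clamp-toℕ n fz

record IsReparam (n m : ℕ) (ρ : ℕ → ℕ) : Set where
  field
    bound : ∀ k → k ≤ m → ρ k ≤ n
    step  : ∀ k → k < m → ρ (suc k) ≡ ρ k ⊎ ρ (suc k) ≡ suc (ρ k)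
    mono  : ∀ k k' → k ≤ k' → k' ≤ m → ρ k ≤ ρ k'
    surj  : ∀ j → j ≤ n → Σ ℕ λ k → k ≤ m × ρ k ≡ j

cap : ℕ → ℕ → ℕ
cap n k with k ≤? n
... | yes _ = k
... | no _ = n

cap-le : ∀ n k → k ≤ n → cap n k ≡ k
cap-le n k le with k ≤? n
... | yes _ = refl
... | no ¬p = ⊥-elim (¬p le)

cap-bound : ∀ n k → cap n k ≤ n
cap-bound n k with k ≤? n
... | yes p = p
... | no _ = ℕP.≤-refl

cap-isReparam : ∀ n m → n ≤ m → IsReparam n m (cap n)
cap-isReparam n m nm = record { bound = λ k _ → cap-bound n k ; step = st ; mono = mo ; surj = λ j le → j , ℕP.≤-trans le nm , cap-le n j le }
  where
    st : ∀ k → k < m → cap n (suc k) ≡ cap n k ⊎ cap n (suc k) ≡ suc (cap n k)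
    st k _ with k ≤? n | suc k ≤? n
    ... | yes p | yes q = inj₂ refl
    ... | yes p | no ¬q = inj₁ (ℕP.≤-antisym (ℕP.≮⇒≥ ¬q) p)
    ... | no ¬p | yes q = ⊥-elim (¬p (ℕP.<⇒≤ q))
    ... | no ¬p | no ¬q = inj₁ refl
    mo : ∀ k k' → k ≤ k' → k' ≤ m → cap n k ≤ cap n k'
    mo k k' le _ with k ≤? n | k' ≤? n
    ... | yes p | yes q = le
    ... | yes p | no ¬q = p
    ... | no ¬p | yes q = ⊥-elim (¬p (ℕP.≤-trans le q))
    ... | no ¬p | no ¬q = ℕP.≤-refl

extendTop : ℕ → ℕ → (ℕ → ℕ) → ℕ → ℕ
extendTop m n R k with k ≤? m
... | yes _ = R k
... | no _ = suc n

extendTop-≤ : ∀ m n R k → k ≤ m → extendTop m n R k ≡ R k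
extendTop-≤ m n R k le with k ≤? m
... | yes _ = refl
... | no ¬p = ⊥-elim (¬p le)

extendTop-top : ∀ m n R → extendTop m n R (suc m) ≡ suc n
extendTop-top m n R with suc m ≤? m
... | yes p = ⊥-elim (ℕP.1+n≰n p)
... | no _ = refl

extendTop-isReparam : ∀ {m n R} → IsReparam n m R → R m ≡ n → IsReparam (suc n) (suc m) (extendTop m n R)
extendTop-isReparam {m} {n} {R} isR Rm≡n = record { bound = bd ; step = st ; mono = mo ; surj = sj }
  where
    open IsReparam isR
    R' = extendTop m n R
    bd : ∀ k → k ≤ suc m → R' k ≤ suc n
    bd k _ with k ≤? m
    ... | yes k≤m = ℕP.m≤n⇒m≤1+n (bound k k≤m)
    ... | no _ = ℕP.≤-refl
    st : ∀ k → k < suc m → R' (suc k) ≡ R' k ⊎ R' (suc k) ≡ suc (R' k)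
    st k lt with k ≤? m | suc k ≤? m
    ... | yes p | yes q = step k q
    ... | yes p | no ¬q = inj₂ (P.cong suc (P.sym (P.trans (P.cong R (ℕP.≤-antisym p (ℕP.≮⇒≥ ¬q))) Rm≡n)))
    ... | no ¬p | _ = ⊥-elim (¬p (ℕP.≤-pred lt))
    mo : ∀ k k' → k ≤ k' → k' ≤ suc m → R' k ≤ R' k'
    mo k k' le le' with k ≤? m | k' ≤? m
    ... | yes p | yes q = mono k k' le q
    ... | yes p | no _ = ℕP.m≤n⇒m≤1+n (bound k p)
    ... | no ¬p | yes q = ⊥-elim (¬p (ℕP.≤-trans le q))
    ... | no _ | no _ = ℕP.≤-refl
    sj : ∀ j → j ≤ suc n → Σ ℕ λ k → k ≤ suc m × R' k ≡ j
    sj j le with ≤-suc-cases le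
    ... | inj₁ jl with surj j jl
    ...   | k , km , e = k , ℕP.m≤n⇒m≤1+n km , P.trans (extendTop-≤ m n R k km) e
    sj j le | inj₂ refl = suc m , ℕP.≤-refl , extendTop-top m n R

∸-suc : ∀ n k → k < n → n ∸ k ≡ suc (n ∸ suc k)
∸-suc (suc n) zero _ = refl
∸-suc (suc n) (suc k) (s≤s lt) = ∸-suc n k lt

module Core {ℓ} (X : Graph ℓ) where
  open Graph X renaming (refl to ≈-refl; sym to ≈-sym; trans to ≈-trans; reflexive to ≈-reflexive) public
  open Paths X public

  vertexSetoid : Setoid ℓ ℓ
  vertexSetoid = record { isEquivalence = isEquivalence }

  module ≈-Reasoning where
    open import Relation.Binary.Reasoning.Setoid vertexSetoid public
      using (begin_; _∎; step-≈-⟩; step-≈-⟨; step-≡-⟩; step-≡-⟨)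
  open ≈-Reasoning

  ≃-refl : ∀ {a} → a ≃ a
  ≃-refl = inj₁ ≈-refl

  -- A walk read as an ℕ-indexed sequence that stays at its end after time len w.
  at : Walk → ℕ → V
  at (n , γ) k = fun γ (clamp n k)

  at-step : ∀ w k → at w k ≃ at w (suc k)
  at-step (n , γ) k with k <? n
  ... | yes lt = adj γ (clamp-adj n k lt)
  ... | no ¬lt = inj₁ (≈-reflexive (P.cong (fun γ) (P.trans (clamp-ge n k (ℕP.≮⇒≥ ¬lt))
                        (P.sym (clamp-ge n (suc k) (ℕP.m≤n⇒m≤1+n (ℕP.≮⇒≥ ¬lt)))))))

  at-toℕ : ∀ {n} (γ : I n ⇒ X) i → at (n , γ) (toℕ i) ≡ fun γ i
  at-toℕ {n} γ i = P.cong (fun γ) (clamp-toℕ n i)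

  at-0 : ∀ w → at w 0 ≡ start w
  at-0 (n , γ) = P.cong (fun γ) (clamp-0 n)

  at-len : ∀ w → at w (len w) ≡ end w
  at-len (n , γ) = P.cong (fun γ) (clamp-ge n n ℕP.≤-refl)

  at-≥len : ∀ w k → len w ≤ k → at w k ≡ end w
  at-≥len (n , γ) k le = P.cong (fun γ) (clamp-ge n k le)

  at-mkPath : ∀ N F st k → k ≤ N → at (N , mkPath N F st) k ≡ F k
  at-mkPath N F st k le = P.cong F (toℕ-clamp N k le)

  Steps : (ℕ → V) → Set ℓ
  Steps F = ∀ k → F k ≃ F (suc k)

  walk : ℕ → (F : ℕ → V) → Steps F → Walk
  walk n F st = n , mkPath n F (λ k _ → st k)

  _≋_ : Walk → Walk → Set ℓ
  _≋_ = Homotopic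

  private module HE = IsEquivalence (EqC.isEquivalence Step)

  ≋-refl : ∀ {a} → a ≋ a
  ≋-refl = HE.refl

  ≋-sym : ∀ {a b} → a ≋ b → b ≋ a
  ≋-sym = HE.sym

  ≋-trans : ∀ {a b c} → a ≋ b → b ≋ c → a ≋ c
  ≋-trans = HE.trans

  step⇒≋ : ∀ {a b} → Step a b → a ≋ b
  step⇒≋ = EqC.return

  ≋-pointwise : ∀ (W W' : Walk) → len W ≡ len W' → (∀ k → k ≤ len W → at W k ≃ at W' k)
         → at W 0 ≈ at W' 0 → at W (len W) ≈ at W' (len W) → W ≋ W'
  ≋-pointwise (n , γ) (.n , δ) refl pt e0 en =
    step⇒≋ (adjacent γ δ (≃0 e0) (≃n en) (λ i → ≃-resp (≈-reflexive (at-toℕ γ i)) (≈-reflexive (at-toℕ δ i))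
                                           (pt (toℕ i) (FP.toℕ≤pred[n] i))))
    where
      ≃0 : at (n , γ) 0 ≈ at (n , δ) 0 → fun γ fz ≈ fun δ fz
      ≃0 e = ≈-trans (≈-sym (≈-reflexive (at-0 (n , γ)))) (≈-trans e (≈-reflexive (at-0 (n , δ))))
      ≃n : at (n , γ) n ≈ at (n , δ) n → fun γ (fromℕ n) ≈ fun δ (fromℕ n)
      ≃n e = ≈-trans (≈-sym (≈-reflexive (at-len (n , γ)))) (≈-trans e (≈-reflexive (at-len (n , δ))))

  ≋-pointwise≈ : ∀ (W W' : Walk) → len W ≡ len W' → (∀ k → k ≤ len W → at W k ≈ at W' k) → W ≋ W'
  ≋-pointwise≈ W W' e pt = ≋-pointwise W W' e (λ k le → inj₁ (pt k le)) (pt 0 z≤n) (pt (len W) ℕP.≤-refl)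

  module Reparametrise {n} (γ : I n ⇒ X) (m : ℕ) (ρ : ℕ → ℕ) (R : IsReparam n m ρ) where
    open IsReparam R
    rpF : ℕ → V
    rpF k = at (n , γ) (ρ k)

    rpSt : ∀ k → k < m → rpF k ≃ rpF (suc k)
    rpSt k lt with step k lt
    ... | inj₁ e = inj₁ (≈-reflexive (P.cong (at (n , γ)) (P.sym e)))
    ... | inj₂ e = P.subst (λ t → rpF k ≃ at (n , γ) t) (P.sym e) (at-step (n , γ) (ρ k))

    reparametrised : Walk
    reparametrised = m , mkPath m rpF rpSt

    at-reparametrised : ∀ k → k ≤ m → at reparametrised k ≡ at (n , γ) (ρ k)
    at-reparametrised k le = at-mkPath m rpF rpSt k le

    private
      rfun : Fin (suc m) → Fin (suc n)
      rfun i = clamp n (ρ (toℕ i))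

      radjℕ : ∀ k → k < m → clamp n (ρ k) ≡ clamp n (ρ (suc k)) ⊎ IAdj n (clamp n (ρ k)) (clamp n (ρ (suc k)))
      radjℕ k lt with step k lt
      ... | inj₁ e = inj₁ (P.cong (clamp n) (P.sym e))
      ... | inj₂ e = inj₂ (P.subst (λ t → IAdj n (clamp n (ρ k)) (clamp n t)) (P.sym e)
                      (clamp-adj n (ρ k) (P.subst (_≤ n) e (bound (suc k) lt))))

      conv : ∀ (k : Fin m) → rfun (inject₁ k) ≡ rfun (fs k) ⊎ IAdj n (rfun (inject₁ k)) (rfun (fs k))
      conv k = P.subst (λ t → clamp n (ρ t) ≡ rfun (fs k) ⊎ IAdj n (clamp n (ρ t)) (rfun (fs k)))
                 (P.sym (FP.toℕ-inject₁ k)) (radjℕ (toℕ k) (FP.toℕ<n k))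

      swp : ∀ {a b : Fin (suc n)} → a ≡ b ⊎ IAdj n a b → b ≡ a ⊎ IAdj n b a
      swp (inj₁ e) = inj₁ (P.sym e)
      swp (inj₂ (inj₁ x)) = inj₂ (inj₂ x)
      swp (inj₂ (inj₂ x)) = inj₂ (inj₁ x)

      r : I m ⇒ I n
      r = record { fun = rfun ; cong = λ { refl → refl }
                 ; adj = λ { (inj₁ (k , refl , refl)) → conv k ; (inj₂ (k , refl , refl)) → swp (conv k) } }

      rsurj : ∀ j → Σ (Fin (suc m)) λ i → fun r i ≡ j
      rsurj j with surj (toℕ j) (FP.toℕ≤pred[n] j)
      ... | k , le , e = fromℕ< (s≤s le) ,
            P.trans (P.cong (λ t → clamp n (ρ t)) (FP.toℕ-fromℕ< (s≤s le))) (P.trans (P.cong (clamp n) e) (clamp-toℕ n j))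

      rmono : ∀ {i j} → i ≤F j → fun r i ≤F fun r j
      rmono {i} {j} le = P.subst₂ _≤_ (P.sym (toℕ-clamp n (ρ (toℕ i)) (bound (toℕ i) (ℕP.≤-trans le (FP.toℕ≤pred[n] j)))))
                                       (P.sym (toℕ-clamp n (ρ (toℕ j)) (bound (toℕ j) (FP.toℕ≤pred[n] j))))
                                       (mono (toℕ i) (toℕ j) le (FP.toℕ≤pred[n] j))

    ≋-reparametrised : (n , γ) ≋ reparametrised
    ≋-reparametrised = step⇒≋ (reparam γ (mkPath m rpF rpSt) r rsurj rmono (λ i → ≈-refl))

  at-cap : ∀ w k → at w (cap (len w) k) ≡ at w k
  at-cap w k with k ≤? len w
  ... | yes _ = refl
  ... | no ¬p = P.trans (at-len w) (P.sym (at-≥len w k (ℕP.<⇒≤ (ℕP.≰⇒> ¬p))))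

  ≋-stretch : ∀ w W → len w ≤ len W → (∀ k → k ≤ len W → at W k ≈ at w k) → w ≋ W
  ≋-stretch (n , γ) W le pt = ≋-trans ≋-reparametrised (≋-pointwise≈ _ W refl pt′)
    where
      open Reparametrise γ (len W) (cap n) (cap-isReparam n (len W) le)
      pt′ : ∀ k → k ≤ len W → at reparametrised k ≈ at W k
      pt′ k k≤ = ≈-trans (≈-reflexive (P.trans (at-reparametrised k k≤) (at-cap (n , γ) k))) (≈-sym (pt k k≤))

  module ReparamMap {m n} (r : I m ⇒ I n) (surj : ∀ j → Σ (Fin (suc m)) λ i → fun r i ≡ j)
                (mono : ∀ {i j} → i ≤F j → fun r i ≤F fun r j) where
    R : ℕ → ℕ
    R k = toℕ (fun r (clamp m k))

    r0 : fun r fz ≡ fz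
    r0 with surj fz
    ... | i , e = FP.toℕ-injective (ℕP.n≤0⇒n≡0 (P.subst (λ t → toℕ (fun r fz) ≤ toℕ t) e (mono {fz} {i} z≤n)))

    rend : fun r (fromℕ m) ≡ fromℕ n
    rend with surj (fromℕ n)
    ... | i , e = FP.toℕ-injective (P.trans (ℕP.≤-antisym (FP.toℕ≤pred[n] (fun r (fromℕ m))) nle) (P.sym (FP.toℕ-fromℕ n)))
      where
        ile : i ≤F fromℕ m
        ile = P.subst (toℕ i ≤_) (P.sym (FP.toℕ-fromℕ m)) (FP.toℕ≤pred[n] i)
        nle : n ≤ toℕ (fun r (fromℕ m))
        nle = P.subst (_≤ toℕ (fun r (fromℕ m))) (P.trans (P.cong toℕ e) (FP.toℕ-fromℕ n)) (mono ile)

    R0 : R 0 ≡ 0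
    R0 = P.cong toℕ (P.trans (P.cong (fun r) (clamp-0 m)) r0)

    Rend : R m ≡ n
    Rend = P.trans (P.cong toℕ (P.trans (P.cong (fun r) (clamp-ge m m ℕP.≤-refl)) rend)) (FP.toℕ-fromℕ n)

    Rbound : ∀ k → R k ≤ n
    Rbound k = FP.toℕ≤pred[n] (fun r (clamp m k))

    Rmono : ∀ k k' → k ≤ k' → k' ≤ m → R k ≤ R k'
    Rmono k k' le le' = mono {clamp m k} {clamp m k'}
      (P.subst₂ _≤_ (P.sym (toℕ-clamp m k (ℕP.≤-trans le le'))) (P.sym (toℕ-clamp m k' le')) le)

    Rstep : ∀ k → k < m → R (suc k) ≡ R k ⊎ R (suc k) ≡ suc (R k)
    Rstep k lt with adj r (clamp-adj m k lt)
    ... | inj₁ e = inj₁ (P.cong toℕ (P.sym e))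
    ... | inj₂ a with IAdj-toℕ a
    ...   | inj₁ e = inj₂ e
    ...   | inj₂ e = ⊥-elim (ℕP.1+n≰n (P.subst (_≤ R (suc k)) e (Rmono k (suc k) (ℕP.n≤1+n k) lt)))

    Rsurj : ∀ j → j ≤ n → Σ ℕ λ k → k ≤ m × R k ≡ j
    Rsurj j le with surj (clamp n j)
    ... | i , e = toℕ i , FP.toℕ≤pred[n] i , P.trans (P.cong (λ t → toℕ (fun r t)) (clamp-toℕ m i))
                                                       (P.trans (P.cong toℕ e) (toℕ-clamp n j le))

    R-isReparam : IsReparam n m R
    R-isReparam = record { bound = λ k _ → Rbound k ; step = Rstep ; mono = Rmono ; surj = Rsurj }

  snocF : Walk → V → ℕ → V
  snocF w a k with k ≤? len w
  ... | yes _ = at w k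
  ... | no _ = a

  snocF-step : ∀ w a → end w ≃ a → Steps (snocF w a)
  snocF-step w a h k with k ≤? len w | suc k ≤? len w
  ... | yes p | yes q = at-step w k
  ... | yes p | no ¬q = ≃-resp (≈-reflexive (P.sym (P.trans (P.cong (at w) kn) (at-len w)))) ≈-refl h
     where kn : k ≡ len w
           kn = ℕP.≤-antisym p (ℕP.≮⇒≥ ¬q)
  ... | no ¬p | yes q = ⊥-elim (¬p (ℕP.<⇒≤ q))
  ... | no ¬p | no ¬q = ≃-refl

  snoc : (w : Walk) (a : V) → end w ≃ a → Walk
  snoc w a h = walk (suc (len w)) (snocF w a) (snocF-step w a h)

  snocF-≤ : ∀ w a k → k ≤ len w → snocF w a k ≡ at w k
  snocF-≤ w a k le with k ≤? len w
  ... | yes _ = refl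
  ... | no ¬p = ⊥-elim (¬p le)

  snocF-top : ∀ w a → snocF w a (suc (len w)) ≡ a
  snocF-top w a with suc (len w) ≤? len w
  ... | yes p = ⊥-elim (ℕP.1+n≰n p)
  ... | no _ = refl

  at-snoc-≤ : ∀ w a h k → k ≤ len w → at (snoc w a h) k ≡ at w k
  at-snoc-≤ w a h k le = P.trans (at-mkPath _ (snocF w a) (λ j _ → snocF-step w a h j) k (ℕP.m≤n⇒m≤1+n le)) (snocF-≤ w a k le)

  at-snoc-top : ∀ w a h → at (snoc w a h) (suc (len w)) ≡ a
  at-snoc-top w a h = P.trans (at-mkPath _ (snocF w a) (λ j _ → snocF-step w a h j) (suc (len w)) ℕP.≤-refl) (snocF-top w a)

  end-snoc : ∀ w a h → end (snoc w a h) ≈ a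
  end-snoc w a h = ≈-reflexive (P.trans (P.sym (at-len (snoc w a h))) (at-snoc-top w a h))

  start-snoc : ∀ w a h → start (snoc w a h) ≈ start w
  start-snoc w a h = ≈-reflexive (P.trans (P.sym (at-0 (snoc w a h))) (P.trans (at-snoc-≤ w a h 0 z≤n) (at-0 w)))

  snoc-pointwise≃ : ∀ w w' a a' h h' → len w ≡ len w' → (∀ k → k ≤ len w → at w k ≃ at w' k) → a ≃ a'
          → ∀ k → k ≤ suc (len w) → at (snoc w a h) k ≃ at (snoc w' a' h') k
  snoc-pointwise≃ w@(n , _) w'@(.n , _) a a' h h' refl pt a≃a' k le with ≤-suc-cases le
  ... | inj₁ k≤n = ≃-resp (≈-reflexive (P.sym (at-snoc-≤ w a h k k≤n))) (≈-reflexive (P.sym (at-snoc-≤ w' a' h' k k≤n))) (pt k k≤n)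
  ... | inj₂ refl = ≃-resp (≈-reflexive (P.sym (at-snoc-top w a h))) (≈-reflexive (P.sym (at-snoc-top w' a' h'))) a≃a'

  snoc-≋-pointwise : ∀ w w' a a' h h' → len w ≡ len w' → (∀ k → k ≤ len w → at w k ≃ at w' k)
          → at w 0 ≈ at w' 0 → a ≈ a' → snoc w a h ≋ snoc w' a' h'
  snoc-≋-pointwise w@(n , _) w'@(.n , _) a a' h h' refl pt e0 a≈a' =
    ≋-pointwise (snoc w a h) (snoc w' a' h') refl (snoc-pointwise≃ w w' a a' h h' refl pt (inj₁ a≈a'))
      (≈-trans (≈-reflexive (at-snoc-≤ w a h 0 z≤n)) (≈-trans e0 (≈-reflexive (P.sym (at-snoc-≤ w' a' h' 0 z≤n)))))
      (≈-trans (≈-reflexive (at-snoc-top w a h)) (≈-trans a≈a' (≈-reflexive (P.sym (at-snoc-top w' a' h')))))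

  snoc-resp : ∀ w a a' h h' → a ≈ a' → snoc w a h ≋ snoc w a' h'
  snoc-resp w a a' h h' e = snoc-≋-pointwise w w a a' h h' refl (λ _ _ → ≃-refl) ≈-refl e

  ≋-snoc-end : ∀ w a h → a ≈ end w → w ≋ snoc w a h
  ≋-snoc-end w a h e = ≋-stretch w (snoc w a h) (ℕP.n≤1+n (len w)) pt
    where
      pt : ∀ k → k ≤ suc (len w) → at (snoc w a h) k ≈ at w k
      pt k le with ≤-suc-cases le
      ... | inj₁ kl = ≈-reflexive (at-snoc-≤ w a h k kl)
      ... | inj₂ refl = ≈-trans (≈-reflexive (at-snoc-top w a h)) (≈-trans e (≈-reflexive (P.sym (at-≥len w (suc (len w)) (ℕP.n≤1+n _)))))

  module SnocReparam {m n} (γ : I n ⇒ X) (δ : I m ⇒ X) (r : I m ⇒ I n)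
            (surj : ∀ j → Σ (Fin (suc m)) λ i → fun r i ≡ j)
            (mono : ∀ {i j} → i ≤F j → fun r i ≤F fun r j)
            (eq : ∀ i → fun δ i ≈ fun γ (fun r i)) where
    open ReparamMap r surj mono

    ρ' : ℕ → ℕ
    ρ' = extendTop m n R

    ρ'-isReparam : IsReparam (suc n) (suc m) ρ'
    ρ'-isReparam = extendTop-isReparam R-isReparam Rend

    snoc-≋-reparam : ∀ a h h' → snoc (n , γ) a h ≋ snoc (m , δ) a h'
    snoc-≋-reparam a h h' = ≋-trans (≋-reparametrised) (≋-pointwise≈ _ _ refl pt)
      where
        W = snoc (n , γ) a h
        open Reparametrise (proj₂ W) (suc m) ρ' ρ'-isReparam
        pt : ∀ k → k ≤ suc m → at reparametrised k ≈ at (snoc (m , δ) a h') k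
        pt k le with ≤-suc-cases le
        ... | inj₁ k≤m = begin
          at reparametrised k        ≡⟨ at-reparametrised k le ⟩
          at W (extendTop m n R k)   ≡⟨ P.cong (at W) (extendTop-≤ m n R k k≤m) ⟩
          at W (R k)                 ≡⟨ at-snoc-≤ (n , γ) a h (R k) (Rbound k) ⟩
          at (n , γ) (R k)           ≡⟨ at-toℕ γ (fun r (clamp m k)) ⟩
          fun γ (fun r (clamp m k))  ≈⟨ eq (clamp m k) ⟨
          at (m , δ) k               ≡⟨ at-snoc-≤ (m , δ) a h' k k≤m ⟨
          at (snoc (m , δ) a h') k   ∎
        ... | inj₂ refl = begin
          at reparametrised (suc m)        ≡⟨ at-reparametrised (suc m) le ⟩
          at W (extendTop m n R (suc m))   ≡⟨ P.cong (at W) (extendTop-top m n R) ⟩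
          at W (suc n)                     ≡⟨ at-snoc-top (n , γ) a h ⟩
          a                                ≡⟨ at-snoc-top (m , δ) a h' ⟨
          at (snoc (m , δ) a h') (suc m)   ∎

  private
    SnocCompatible : Rel Walk ℓ
    SnocCompatible w w' = end w ≈ end w' × (∀ a h h' → snoc w a h ≋ snoc w' a h')

    SnocCompatible-isEquivalence : IsEquivalence SnocCompatible
    SnocCompatible-isEquivalence = record
      { refl  = λ {w} → ≈-refl , λ a h h' → snoc-resp w a a h h' ≈-refl
      ; sym   = λ (e , f) → ≈-sym e , λ a h h' → ≋-sym (f a h' h)
      ; trans = λ (e₁ , f₁) (e₂ , f₂) → ≈-trans e₁ e₂ , λ a h h'' →
                  ≋-trans (f₁ a h (≃-resp e₁ ≈-refl h)) (f₂ a (≃-resp e₁ ≈-refl h) h'') }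

    step⇒SnocCompatible : ∀ {w w'} → Step w w' → SnocCompatible w w'
    step⇒SnocCompatible s@(reparam γ δ r surj mono eq) = end-hom (step⇒≋ s) , SnocReparam.snoc-≋-reparam γ δ r surj mono eq
    step⇒SnocCompatible (adjacent γ δ e0 en pt) = en , λ a h h' →
      snoc-≋-pointwise _ _ a a h h' refl (λ k _ → pt (clamp _ k))
        (≈-trans (≈-reflexive (at-0 (_ , γ))) (≈-trans e0 (≈-reflexive (P.sym (at-0 (_ , δ)))))) ≈-refl

  snoc-cong : ∀ {w w'} → w ≋ w' → ∀ a h h' → snoc w a h ≋ snoc w' a h'
  snoc-cong p = proj₂ (EqC.fold SnocCompatible-isEquivalence step⇒SnocCompatible p)

  at-snoc-end : ∀ w a h → a ≈ end w → ∀ k → at (snoc w a h) k ≈ at w k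
  at-snoc-end w a h e k with k ≤? len w
  ... | yes k≤n = ≈-reflexive (at-snoc-≤ w a h k k≤n)
  ... | no k≰n = begin
    at (snoc w a h) k  ≡⟨ at-≥len (snoc w a h) k (ℕP.≰⇒> k≰n) ⟩
    end (snoc w a h)   ≈⟨ end-snoc w a h ⟩
    a                  ≈⟨ e ⟩
    end w              ≡⟨ at-≥len w k (ℕP.<⇒≤ (ℕP.≰⇒> k≰n)) ⟨
    at w k             ∎

  -- The backtracking walk w·a·(end w) is pointwise adjacent to w·(end w)·(end w), a reparametrisation of w.
  ≋-snoc-backtrack : ∀ w a h h' → w ≋ snoc (snoc w a h) (end w) h'
  ≋-snoc-backtrack w a h h' = ≋-trans (≋-stretch w W₀ (ℕP.m≤n⇒m≤1+n (ℕP.n≤1+n _)) W₀≈w)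
    (snoc-≋-pointwise W₁ (snoc w a h) (end w) (end w) h₁ h' refl
       (snoc-pointwise≃ w w (end w) a ≃-refl h refl (λ _ _ → ≃-refl) h)
       (≈-trans (≈-reflexive (at-snoc-≤ w (end w) ≃-refl 0 z≤n)) (≈-reflexive (P.sym (at-snoc-≤ w a h 0 z≤n))))
       ≈-refl)
    where
      W₁ = snoc w (end w) ≃-refl
      h₁ : end W₁ ≃ end w
      h₁ = inj₁ (end-snoc w (end w) ≃-refl)
      W₀ = snoc W₁ (end w) h₁
      W₀≈w : ∀ k → k ≤ len W₀ → at W₀ k ≈ at w k
      W₀≈w k _ = ≈-trans (at-snoc-end W₁ (end w) h₁ (≈-sym (end-snoc w (end w) ≃-refl)) k)
                         (at-snoc-end w (end w) ≃-refl ≈-refl k)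

  -- w·a·d·d is pointwise adjacent to w·(end w)·b·c, which is homotopic to w·b·c.
  snoc-square : ∀ w a b c d (h₁ : end w ≃ a) (h₂ : end (snoc w a h₁) ≃ d) (h₃ : end w ≃ b) (h₄ : end (snoc w b h₃) ≃ c)
              → d ≃ b → d ≈ c → snoc (snoc w a h₁) d h₂ ≋ snoc (snoc w b h₃) c h₄
  snoc-square w a b c d h₁ h₂ h₃ h₄ d≃b d≈c =
    ≋-trans (≋-snoc-end Wad d hd (≈-sym (end-snoc Wa d h₂)))
      (≋-trans (snoc-≋-pointwise Wad (snoc We b h₃') d c hd h₄' refl
                 (snoc-pointwise≃ Wa We d b h₂ h₃' refl
                    (snoc-pointwise≃ w w a (end w) h₁ ≃-refl refl (λ _ _ → ≃-refl) (≃-sym h₁)) d≃b)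
                 start≈ d≈c)
        (snoc-cong (snoc-cong (≋-sym (≋-snoc-end w (end w) ≃-refl ≈-refl)) b h₃' h₃) c h₄' h₄))
    where
      Wa = snoc w a h₁
      Wad = snoc Wa d h₂
      We = snoc w (end w) ≃-refl
      h₃' : end We ≃ b
      h₃' = ≃-resp (≈-sym (end-snoc w (end w) ≃-refl)) ≈-refl h₃
      h₄' : end (snoc We b h₃') ≃ c
      h₄' = ≃-resp (≈-trans (end-snoc w b h₃) (≈-sym (end-snoc We b h₃'))) ≈-refl h₄
      hd : end Wad ≃ d
      hd = inj₁ (end-snoc Wa d h₂)
      start≈ : at Wa 0 ≈ at We 0
      start≈ = ≈-reflexive (P.trans (at-snoc-≤ w a h₁ 0 z≤n) (P.sym (at-snoc-≤ w (end w) ≃-refl 0 z≤n)))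

  concat-fun-< : ∀ {n m} (γ : I n ⇒ X) (δ : I m ⇒ X) e (i : Fin (suc (n + m))) → toℕ i < n →
              fun (proj₂ (concat (n , γ) (m , δ) e)) i ≈ at (n , γ) (toℕ i)
  concat-fun-< {n} γ δ e i lt with toℕ i <? n
  ... | no ¬p = ⊥-elim (¬p lt)
  ... | yes p with toℕ i <? suc n
  ... | yes q = ≈-refl
  ... | no ¬q = ⊥-elim (¬q (ℕP.m<n⇒m<1+n lt))

  concat-fun-≥ : ∀ {n m} (γ : I n ⇒ X) (δ : I m ⇒ X) e (i : Fin (suc (n + m))) → ¬ (toℕ i < n) →
              fun (proj₂ (concat (n , γ) (m , δ) e)) i ≈ at (m , δ) (toℕ i ∸ n)
  concat-fun-≥ {n} {m} γ δ e i nlt with toℕ i <? n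
  ... | yes p = ⊥-elim (nlt p)
  ... | no _ with (toℕ i ∸ n) <? suc m
  ... | yes q = ≈-refl
  ... | no _ = ≈-refl

  at-concat-< : ∀ w w' e k → k < len w → at (concat w w' e) k ≈ at w k
  at-concat-< (n , γ) (m , δ) e k lt =
    ≈-trans (concat-fun-< γ δ e (clamp (n + m) k) (P.subst (_< n) (P.sym tk) lt)) (≈-reflexive (P.cong (at (n , γ)) tk))
    where tk = toℕ-clamp (n + m) k (ℕP.≤-trans (ℕP.<⇒≤ lt) (ℕP.m≤m+n n m))

  at-concat-≥ : ∀ w w' e k → len w ≤ k → k ≤ len w + len w' → at (concat w w' e) k ≈ at w' (k ∸ len w)
  at-concat-≥ (n , γ) (m , δ) e k le le' =
    ≈-trans (concat-fun-≥ γ δ e (clamp (n + m) k) (λ lt → ℕP.<⇒≱ (P.subst (_< n) tk lt) le))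
            (≈-reflexive (P.cong (λ t → at (m , δ) (t ∸ n)) tk))
    where tk = toℕ-clamp (n + m) k le'

  take : ℕ → Walk → Walk
  take k w = walk k (at w) (at-step w)

  at-take : ∀ k w j → j ≤ k → at (take k w) j ≡ at w j
  at-take k w j le = at-mkPath k (at w) (λ j _ → at-step w j) j le

  end-take : ∀ k w → end (take k w) ≈ at w k
  end-take k w = ≈-reflexive (P.trans (P.sym (at-len (take k w))) (at-take k w k ℕP.≤-refl))

  concat-edge-≋-snoc : ∀ w {v} (h : end w ∼ v) → concat w (edge h) ≈-refl ≋ snoc w v (inj₂ h)
  concat-edge-≋-snoc w {v} h = ≋-pointwise≈ _ _ (ℕP.+-comm (len w) 1) pt
    where
      n = len w
      pt : ∀ k → k ≤ n + 1 → at (concat w (edge h) ≈-refl) k ≈ at (snoc w v (inj₂ h)) k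
      pt k le with k <? n
      ... | yes lt = ≈-trans (at-concat-< w (edge h) ≈-refl k lt) (≈-reflexive (P.sym (at-snoc-≤ w v (inj₂ h) k (ℕP.<⇒≤ lt))))
      ... | no ¬lt with ≤-suc-cases (P.subst (k ≤_) (ℕP.+-comm n 1) le)
      ...   | inj₁ k≤n = begin
        at (concat w (edge h) ≈-refl) k  ≈⟨ at-concat-≥ w (edge h) ≈-refl k (ℕP.≮⇒≥ ¬lt) le ⟩
        at (edge h) (k ∸ n)              ≡⟨ P.cong (at (edge h)) (P.trans (P.cong (_∸ n) k≡n) (ℕP.n∸n≡0 n)) ⟩
        end w                            ≡⟨ at-len w ⟨
        at w n                           ≡⟨ P.cong (at w) k≡n ⟨
        at w k                           ≡⟨ at-snoc-≤ w v (inj₂ h) k k≤n ⟨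
        at (snoc w v (inj₂ h)) k         ∎
        where k≡n = ℕP.≤-antisym k≤n (ℕP.≮⇒≥ ¬lt)
      ...   | inj₂ refl = begin
        at (concat w (edge h) ≈-refl) (suc n)  ≈⟨ at-concat-≥ w (edge h) ≈-refl (suc n) (ℕP.≮⇒≥ ¬lt) le ⟩
        at (edge h) (suc n ∸ n)                ≡⟨ P.cong (at (edge h)) (ℕP.m+n∸n≡m 1 n) ⟩
        v                                      ≡⟨ at-snoc-top w v (inj₂ h) ⟨
        at (snoc w v (inj₂ h)) (suc n)         ∎

  reverse-step : ∀ w k → at w (len w ∸ k) ≃ at w (len w ∸ suc k)
  reverse-step w k with k <? len w
  ... | yes lt = P.subst (λ t → at w t ≃ at w (len w ∸ suc k)) (P.sym (∸-suc (len w) k lt))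
                   (≃-sym (at-step w (len w ∸ suc k)))
  ... | no ¬lt = inj₁ (≈-reflexive (P.cong (at w) (P.trans (ℕP.m≤n⇒m∸n≡0 (ℕP.≮⇒≥ ¬lt))
                                             (P.sym (ℕP.m≤n⇒m∸n≡0 (ℕP.m≤n⇒m≤1+n (ℕP.≮⇒≥ ¬lt)))))))

  reverse : Walk → Walk
  reverse w = walk (len w) (λ k → at w (len w ∸ k)) (reverse-step w)

  at-reverse : ∀ w k → k ≤ len w → at (reverse w) k ≡ at w (len w ∸ k)
  at-reverse w k le = at-mkPath (len w) (λ k → at w (len w ∸ k)) (λ j _ → reverse-step w j) k le

  at-reverse-reverse : ∀ w k → k ≤ len w → at (reverse (reverse w)) k ≈ at w k
  at-reverse-reverse w k le = ≈-reflexive (P.trans (at-reverse (reverse w) k le) (P.trans (at-reverse w (len w ∸ k) (ℕP.m∸n≤m _ k))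
                     (P.cong (at w) (ℕP.m∸[m∸n]≡n le))))

  start-reverse : ∀ w → start (reverse w) ≈ end w
  start-reverse w = ≈-reflexive (P.trans (P.sym (at-0 (reverse w))) (P.trans (at-reverse w 0 z≤n) (at-len w)))

  end-reverse : ∀ w → end (reverse w) ≈ start w
  end-reverse w = ≈-reflexive (P.trans (P.sym (at-len (reverse w))) (P.trans (at-reverse w (len w) ℕP.≤-refl)
               (P.trans (P.cong (at w) (ℕP.n∸n≡0 (len w))) (at-0 w))))

  at-concat-≤ : ∀ w w' e k → k ≤ len w → at (concat w w' e) k ≈ at w k
  at-concat-≤ w w' e k le with k <? len w
  ... | yes lt = at-concat-< w w' e k lt
  ... | no ¬lt = begin
    at (concat w w' e) k  ≈⟨ at-concat-≥ w w' e k (ℕP.≮⇒≥ ¬lt) (ℕP.≤-trans le (ℕP.m≤m+n _ _)) ⟩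
    at w' (k ∸ len w)     ≡⟨ P.cong (at w') (P.trans (P.cong (_∸ len w) k≡n) (ℕP.n∸n≡0 (len w))) ⟩
    at w' 0               ≡⟨ at-0 w' ⟩
    start w'              ≈⟨ e ⟨
    end w                 ≡⟨ at-len w ⟨
    at w (len w)          ≡⟨ P.cong (at w) k≡n ⟨
    at w k                ∎
    where k≡n = ℕP.≤-antisym le (ℕP.≮⇒≥ ¬lt)

module Squares {ℓ} (X : Graph ℓ) where
  open Graph X renaming (refl to ≈-refl; sym to ≈-sym; trans to ≈-trans)

  squareF : (a00 a10 a01 a11 : V) → Fin 2 × Fin 2 → V
  squareF a00 a10 a01 a11 (fz , fz) = a00
  squareF a00 a10 a01 a11 (fs fz , fz) = a10
  squareF a00 a10 a01 a11 (fz , fs fz) = a01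
  squareF a00 a10 a01 a11 (fs fz , fs fz) = a11

  squareMap : (a00 a10 a01 a11 : V) → a00 ≃ a10 → a00 ≃ a01 → a10 ≃ a11 → a01 ≃ a11 → Square ⇒ X
  squareMap a00 a10 a01 a11 e1 e2 e3 e4 = record { fun = F ; cong = λ { (refl , refl) → ≈-refl } ; adj = ad }
    where
      F = squareF a00 a10 a01 a11
      ad : ∀ {x y} → Graph._∼_ Square x y → F x ≃ F y
      ad {_ , fz} (inj₁ (inj₁ (fz , refl , refl) , refl)) = e1
      ad {_ , fs fz} (inj₁ (inj₁ (fz , refl , refl) , refl)) = e4
      ad {_ , fz} (inj₁ (inj₂ (fz , refl , refl) , refl)) = ≃-sym e1
      ad {_ , fs fz} (inj₁ (inj₂ (fz , refl , refl) , refl)) = ≃-sym e4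
      ad {fz , _} (inj₂ (refl , inj₁ (fz , refl , refl))) = e2
      ad {fs fz , _} (inj₂ (refl , inj₁ (fz , refl , refl))) = e3
      ad {fz , _} (inj₂ (refl , inj₂ (fz , refl , refl))) = ≃-sym e2
      ad {fs fz , _} (inj₂ (refl , inj₂ (fz , refl , refl))) = ≃-sym e3

  path3F : (a b c d : V) → ℕ → V
  path3F a b c d 0 = a
  path3F a b c d 1 = b
  path3F a b c d 2 = c
  path3F a b c d _ = d

  path3 : (a b c d : V) → a ≃ b → b ≃ c → c ≃ d → I 3 ⇒ X
  path3 a b c d e1 e2 e3 = Paths.mkPath X 3 (path3F a b c d) st
    where
      st : ∀ k → k < 3 → path3F a b c d k ≃ path3F a b c d (suc k)
      st 0 _ = e1
      st 1 _ = e2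
      st 2 _ = e3
      st (suc (suc (suc k))) (s≤s (s≤s (s≤s ())))

module Lifting {ℓ} (X : Graph ℓ) (Y : Graph ℓ) (p : Y ⇒ X) (cov : IsCovering p) where
  open Core X
  module Y = Graph Y
  open IsCovering cov

  proj-≃ : ∀ {a b} → a Y.≃ b → fun p a ≃ fun p b
  proj-≃ (inj₁ e) = inj₁ (cong p e)
  proj-≃ (inj₂ h) = adj p h

  liftNext : ∀ {x x'} (z : Y.V) → fun p z ≈ x → x ≃ x' → Σ Y.V λ z' → z Y.≃ z' × fun p z' ≈ x'
  liftNext z pz h = nbhd-surjective z (≃-resp (≈-sym pz) ≈-refl h)

  liftSeq : (F : ℕ → V) → Steps F → (y : Y.V) → fun p y ≈ F 0 → (k : ℕ) → Σ Y.V λ z → fun p z ≈ F k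
  liftSeq F st y e zero = y , e
  liftSeq F st y e (suc k) =
    let (z , pz) = liftSeq F st y e k
        (z' , _ , pz') = liftNext z pz (st k)
    in z' , pz'

  liftSeq-step : ∀ F st y e k → proj₁ (liftSeq F st y e k) Y.≃ proj₁ (liftSeq F st y e (suc k))
  liftSeq-step F st y e k = proj₁ (proj₂ (liftNext _ (proj₂ (liftSeq F st y e k)) (st k)))

  lift-unique : ∀ (A B : ℕ → Y.V) n → (∀ k → k < n → A k Y.≃ A (suc k)) → (∀ k → k < n → B k Y.≃ B (suc k))
       → (∀ k → k ≤ n → fun p (A k) ≈ fun p (B k)) → A 0 Y.≈ B 0 → ∀ k → k ≤ n → A k Y.≈ B k
  lift-unique A B n sa sb pp e0 zero _ = e0
  lift-unique A B n sa sb pp e0 (suc k) le =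
    nbhd-injective (A k) (sa k le) (Y.≃-resp (Y.sym ih) Y.refl (sb k le)) (pp (suc k) le)
    where ih = lift-unique A B n sa sb pp e0 k (ℕP.≤-trans (ℕP.n≤1+n k) le)

  start≈at-0 : ∀ w {y} → fun p y ≈ start w → fun p y ≈ at w 0
  start≈at-0 w e = ≈-trans e (≈-reflexive (P.sym (at-0 w)))

  lift : (w : Walk) (y : Y.V) → fun p y ≈ start w → ℕ → Y.V
  lift w y e k = proj₁ (liftSeq (at w) (at-step w) y (start≈at-0 w e) k)

  lift-step : ∀ w y e k → lift w y e k Y.≃ lift w y e (suc k)
  lift-step w y e k = liftSeq-step (at w) (at-step w) y (start≈at-0 w e) k

  lift-proj : ∀ w y e k → fun p (lift w y e k) ≈ at w k
  lift-proj w y e k = proj₂ (liftSeq (at w) (at-step w) y (start≈at-0 w e) k)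

  endLift : (w : Walk) (y : Y.V) → fun p y ≈ start w → Y.V
  endLift w y e = lift w y e (len w)

  proj-endLift : ∀ w y e → fun p (endLift w y e) ≈ end w
  proj-endLift w y e = ≈-trans (lift-proj w y e (len w)) (≈-reflexive (at-len w))

  lift-characterisation : ∀ w y e (A : ℕ → Y.V) → (∀ k → k < len w → A k Y.≃ A (suc k))
            → (∀ k → k ≤ len w → fun p (A k) ≈ at w k) → A 0 Y.≈ y → ∀ k → k ≤ len w → A k Y.≈ lift w y e k
  lift-characterisation w y e A sa pa a0 = lift-unique A (lift w y e) (len w) sa (λ k _ → lift-step w y e k)
    (λ k le → ≈-trans (pa k le) (≈-sym (lift-proj w y e k))) a0

  lift-pointwise : ∀ w w' y y' e e' n → (∀ k → k ≤ n → at w k ≈ at w' k) → y Y.≈ y' →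
                   ∀ k → k ≤ n → lift w y e k Y.≈ lift w' y' e' k
  lift-pointwise w w' y y' e e' n pt yy = lift-unique (lift w y e) (lift w' y' e') n (λ k _ → lift-step w y e k) (λ k _ → lift-step w' y' e' k)
    (λ k le → ≈-trans (lift-proj w y e k) (≈-trans (pt k le) (≈-sym (lift-proj w' y' e' k)))) yy

  endLift-pointwise : ∀ w w' y y' e e' → len w ≡ len w' → (∀ k → k ≤ len w → at w k ≈ at w' k) → y Y.≈ y' →
                      endLift w y e Y.≈ endLift w' y' e'
  endLift-pointwise w w' y y' e e' eq pt yy = P.subst (λ t → lift w y e (len w) Y.≈ lift w' y' e' t) eq
                                     (lift-pointwise w w' y y' e e' (len w) pt yy (len w) ℕP.≤-refl)

  endLift-cong : ∀ w y y' e e' → y Y.≈ y' → endLift w y e Y.≈ endLift w y' e'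
  endLift-cong w y y' e e' yy = endLift-pointwise w w y y' e e' refl (λ k _ → ≈-refl) yy

  endLift-snoc : ∀ c v h y e e' → endLift c y e Y.≃ endLift (snoc c v h) y e'
  endLift-snoc c v h y e e' =
    Y.≃-resp (Y.sym (lift-pointwise c (snoc c v h) y y e e' (len c)
                       (λ k le → ≈-reflexive (P.sym (at-snoc-≤ c v h k le))) Y.refl (len c) ℕP.≤-refl))
             Y.refl (lift-step (snoc c v h) y e' (len c))

  square-lift : ∀ {a0 a1 b0 b1} → a0 Y.≃ a1 → b0 Y.≃ b1 → a0 Y.≃ b0 → fun p a1 ≃ fun p b1 → a1 Y.≃ b1
  square-lift {a0} {a1} {b0} {b1} sa sb ab pab =
    square (Squares.path3 Y a1 a0 b0 b1 (Y.≃-sym sa) ab sb)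
           (Squares.squareMap X (fun p a0) (fun p a1) (fun p b0) (fun p b1) (proj-≃ sa) (proj-≃ ab) pab (proj-≃ sb))
           ≈-refl ≈-refl ≈-refl ≈-refl

  private
    SameEndLift : Rel Walk ℓ
    SameEndLift w w' = start w ≈ start w' × (∀ y e e' → endLift w y e Y.≈ endLift w' y e')

    SameEndLift-isEquivalence : IsEquivalence SameEndLift
    SameEndLift-isEquivalence = record
      { refl  = λ {w} → ≈-refl , λ y e e' → endLift-cong w y y e e' Y.refl
      ; sym   = λ (s , f) → ≈-sym s , λ y e e' → Y.sym (f y e' e)
      ; trans = λ (s₁ , f₁) (s₂ , f₂) → ≈-trans s₁ s₂ , λ y e e' →
                  Y.trans (f₁ y e (≈-trans e s₁)) (f₂ y (≈-trans e s₁) e') }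

    step⇒SameEndLift : ∀ {w w'} → Step w w' → SameEndLift w w'
    step⇒SameEndLift (reparam {m} {n} γ δ r surj mono eq) =
      ≈-sym (≈-trans (eq fz) (≈-reflexive (P.cong (fun γ) r0))) , main
      where
        open ReparamMap r surj mono
        main : ∀ y e e' → endLift (n , γ) y e Y.≈ endLift (m , δ) y e'
        main y e e' = P.subst (λ t → lift (n , γ) y e t Y.≈ endLift (m , δ) y e') Rend
                        (lift-characterisation (m , δ) y e' C sc pc (Y.reflexive (P.cong A R0)) m ℕP.≤-refl)
          where
            A = lift (n , γ) y e
            C : ℕ → Y.V
            C k = A (R k)
            sc : ∀ k → k < m → C k Y.≃ C (suc k)
            sc k lt with Rstep k lt
            ... | inj₁ q = inj₁ (Y.reflexive (P.cong A (P.sym q)))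
            ... | inj₂ q = P.subst (λ t → C k Y.≃ A t) (P.sym q) (lift-step (n , γ) y e (R k))
            pc : ∀ k → k ≤ m → fun p (C k) ≈ at (m , δ) k
            pc k _ = ≈-trans (lift-proj (n , γ) y e (R k)) (≈-trans (≈-reflexive (at-toℕ γ (fun r (clamp m k)))) (≈-sym (eq (clamp m k))))
    -- Lifts of pointwise adjacent walks stay pointwise adjacent, one square-lifting at a time.
    step⇒SameEndLift (adjacent {n} γ δ e0 en pt) = e0 , main
      where
        main : ∀ y e e' → endLift (n , γ) y e Y.≈ endLift (n , δ) y e'
        main y e e' = nbhd-injective (A n) (inj₁ Y.refl) (ab n ℕP.≤-refl)
                        (≈-trans (proj-endLift (n , γ) y e) (≈-trans en (≈-sym (proj-endLift (n , δ) y e'))))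
          where
            A = lift (n , γ) y e
            B = lift (n , δ) y e'
            ab : ∀ k → k ≤ n → A k Y.≃ B k
            ab zero _ = inj₁ Y.refl
            ab (suc k) le = square-lift (lift-step (n , γ) y e k) (lift-step (n , δ) y e' k) (ab k (ℕP.≤-trans (ℕP.n≤1+n k) le))
                              (≃-resp (≈-sym (lift-proj (n , γ) y e (suc k))) (≈-sym (lift-proj (n , δ) y e' (suc k)))
                                 (pt (clamp n (suc k))))

  endLift-≋ : ∀ {w w'} → w ≋ w' → ∀ y e e' → endLift w y e Y.≈ endLift w' y e'
  endLift-≋ p = proj₂ (EqC.fold SameEndLift-isEquivalence step⇒SameEndLift p)

  endLift-reverse : ∀ w y e e' → endLift (reverse w) (endLift w y e) e' Y.≈ y
  endLift-reverse w y e e' = P.subst (λ t → N (len w) Y.≈ M t) (ℕP.n∸n≡0 (len w)) (claim (len w) ℕP.≤-refl)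
    where
      n = len w
      M = lift w y e
      N = lift (reverse w) (endLift w y e) e'
      claim : ∀ k → k ≤ n → N k Y.≈ M (n ∸ k)
      claim zero _ = Y.refl
      claim (suc k) le = nbhd-injective (M (n ∸ k)) (Y.≃-resp ih Y.refl (lift-step (reverse w) (endLift w y e) e' k)) mstep
                           (≈-trans (lift-proj (reverse w) (endLift w y e) e' (suc k))
                             (≈-trans (≈-reflexive (at-reverse w (suc k) le)) (≈-sym (lift-proj w y e (n ∸ suc k)))))
        where
          ih = claim k (ℕP.≤-trans (ℕP.n≤1+n k) le)
          mstep : M (n ∸ k) Y.≃ M (n ∸ suc k)
          mstep = P.subst (λ t → M t Y.≃ M (n ∸ suc k)) (P.sym (∸-suc n k le)) (Y.≃-sym (lift-step w y e (n ∸ suc k)))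

  endLift-reverse′ : ∀ w y e e' → endLift w (endLift (reverse w) y e) e' Y.≈ y
  endLift-reverse′ w y e e' =
    Y.trans (endLift-pointwise w (reverse (reverse w)) z z e' e'' refl (λ k le → ≈-sym (at-reverse-reverse w k le)) Y.refl)
                             (endLift-reverse (reverse w) y e e'')
    where
      z = endLift (reverse w) y e
      e'' : fun p z ≈ start (reverse (reverse w))
      e'' = ≈-trans (proj-endLift (reverse w) y e) (≈-sym (start-reverse (reverse w)))

  endLift-concat : ∀ c a b y e e1 e2 → len c ≡ len a + len b
    → (∀ j → j ≤ len a → at c j ≈ at a j) → (∀ j → j ≤ len b → at c (len a + j) ≈ at b j)
    → endLift c y e Y.≈ endLift b (endLift a y e1) e2
  endLift-concat c a b y e e1 e2 eq pt1 pt2 =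
    P.subst (λ t → lift c y e t Y.≈ endLift b z e2) (P.sym eq)
      (lift-unique A B (len b) sA (λ k _ → lift-step b z e2 k) pp A0 (len b) ℕP.≤-refl)
    where
      la = len a
      z = endLift a y e1
      A : ℕ → Y.V
      A j = lift c y e (la + j)
      B = lift b z e2
      sA : ∀ k → k < len b → A k Y.≃ A (suc k)
      sA k _ = P.subst (λ t → A k Y.≃ lift c y e t) (P.sym (ℕP.+-suc la k)) (lift-step c y e (la + k))
      pp : ∀ k → k ≤ len b → fun p (A k) ≈ fun p (B k)
      pp k le = ≈-trans (lift-proj c y e (la + k)) (≈-trans (pt2 k le) (≈-sym (lift-proj b z e2 k)))
      A0 : A 0 Y.≈ B 0
      A0 = P.subst (λ t → lift c y e t Y.≈ z) (P.sym (ℕP.+-identityʳ la)) (lift-pointwise c a y y e e1 la pt1 Y.refl la ℕP.≤-refl)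

module UniversalCoverIsCovering {ℓ} (X : Graph ℓ) (x₀ : Graph.V X) where
  open Core X
  open UniversalCover X x₀ using (UVert; UC; proj)
  module U = Graph UC

  uend : UVert → V
  uend a = end (proj₁ a)

  uend-≃ : ∀ {y z} → y U.≃ z → uend y ≃ uend z
  uend-≃ {y} {z} (inj₁ e) = inj₁ (cong proj {y} {z} e)
  uend-≃ {y} {z} (inj₂ a) = adj proj {y} {z} a

  end-concat-edge : ∀ w {v} (h : end w ∼ v) → end (concat w (edge h) ≈-refl) ≈ v
  end-concat-edge w h = end-concat w (edge h) ≈-refl

  neighbour-≋-snoc : ∀ {y z : UVert} → y U.≃ z → (h : uend y ≃ uend z) → proj₁ z ≋ snoc (proj₁ y) (uend z) h
  neighbour-≋-snoc {y} {z} (inj₁ e) h = ≋-trans (≋-sym e) (≋-snoc-end (proj₁ y) (uend z) h (end-hom (≋-sym e)))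
  neighbour-≋-snoc {y} {z} (inj₂ (inj₁ (c , v , hv , yc , cez))) h =
    ≋-trans (≋-sym cez) (≋-trans (concat-edge-≋-snoc (proj₁ c) hv) (≋-trans (snoc-cong (≋-sym yc) v (inj₂ hv) h')
      (snoc-resp (proj₁ y) v (uend z) h' h vz)))
    where
      vz : v ≈ uend z
      vz = ≈-trans (≈-sym (end-concat-edge (proj₁ c) hv)) (end-hom cez)
      h' : uend y ≃ v
      h' = ≃-resp ≈-refl (≈-sym vz) h
  neighbour-≋-snoc {y} {z} (inj₂ (inj₂ (c , v , hv , zc , cey))) h =
    ≋-trans zc (≋-trans (≋-snoc-backtrack c' v (inj₂ hv) hb) (≋-trans (snoc-cong (≋-sym (concat-edge-≋-snoc c' hv)) (end c') hb hb')
      (≋-trans (snoc-cong cey (end c') hb' hy) (snoc-resp (proj₁ y) (end c') (uend z) hy h cz))))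
    where
      c' = proj₁ c
      cz : end c' ≈ uend z
      cz = end-hom (≋-sym zc)
      hb : end (snoc c' v (inj₂ hv)) ≃ end c'
      hb = ≃-resp (≈-sym (end-snoc c' v (inj₂ hv))) ≈-refl (inj₂ (∼-sym hv))
      hb' : end (concat c' (edge hv) ≈-refl) ≃ end c'
      hb' = ≃-resp (≈-sym (end-concat-edge c' hv)) ≈-refl (inj₂ (∼-sym hv))
      hy : uend y ≃ end c'
      hy = ≃-resp (end-hom cey) ≈-refl hb'

  proj-nbhd-injective : ∀ y {z z'} → y U.≃ z → y U.≃ z' → uend z ≈ uend z' → z U.≈ z'
  proj-nbhd-injective y {z} {z'} yz yz' e =
    ≋-trans (neighbour-≋-snoc {y} {z} yz (uend-≃ {y} {z} yz))
      (≋-trans (snoc-resp (proj₁ y) (uend z) (uend z') (uend-≃ {y} {z} yz) (uend-≃ {y} {z'} yz') e)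
               (≋-sym (neighbour-≋-snoc {y} {z'} yz' (uend-≃ {y} {z'} yz'))))

  proj-nbhd-surjective : ∀ y {w} → uend y ≃ w → Σ UVert λ z → y U.≃ z × uend z ≈ w
  proj-nbhd-surjective y (inj₁ e) = y , inj₁ ≋-refl , e
  proj-nbhd-surjective y {w} (inj₂ h) = (concat (proj₁ y) (edge h) ≈-refl , ≈-trans (start-concat (proj₁ y) (edge h) ≈-refl) (proj₂ y)) ,
                           inj₂ (inj₁ (y , w , h , ≋-refl , ≋-refl)) , end-concat-edge (proj₁ y) h

  -- u₀ and u₂ are extensions of u₁ by one step, so snoc-square turns u₃ into an extension of u₀ by one step.
  proj-square : (u : I 3 ⇒ UC) (v : Square ⇒ X)
             → uend (fun u fz) ≈ fun v (fs fz , fz)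
             → uend (fun u (fs fz)) ≈ fun v (fz , fz)
             → uend (fun u (fs (fs fz))) ≈ fun v (fz , fs fz)
             → uend (fun u (fs (fs (fs fz)))) ≈ fun v (fs fz , fs fz)
             → fun u fz U.≃ fun u (fs (fs (fs fz)))
  proj-square u v c0 c1 c2 c3 = u₀≃u₃ h03
    where
      u0 = fun u fz
      u1 = fun u (fs fz)
      u2 = fun u (fs (fs fz))
      u3 = fun u (fs (fs (fs fz)))
      s01 : u0 U.≃ u1
      s01 = adj u {fz} {fs fz} (inj₁ (fz , refl , refl))
      s12 : u1 U.≃ u2
      s12 = adj u {fs fz} {fs (fs fz)} (inj₁ (fs fz , refl , refl))
      s23 : u2 U.≃ u3
      s23 = adj u {fs (fs fz)} {fs (fs (fs fz))} (inj₁ (fs (fs fz) , refl , refl))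
      E0 = uend u0
      E2 = uend u2
      E3 = uend u3
      w = proj₁ u1
      vv : fun v (fs fz , fz) ≃ fun v (fs fz , fs fz)
      vv = adj v {fs fz , fz} {fs fz , fs fz} (inj₂ (refl , inj₁ (fz , refl , refl)))
      h03 : E0 ≃ E3
      h03 = ≃-resp (≈-sym c0) (≈-sym c3) vv
      h10 : end w ≃ E0
      h10 = uend-≃ {u1} {u0} (U.≃-sym {u0} {u1} s01)
      h12 : end w ≃ E2
      h12 = uend-≃ {u1} {u2} s12
      h23 : E2 ≃ E3
      h23 = uend-≃ {u2} {u3} s23
      N0 : proj₁ u0 ≋ snoc w E0 h10
      N0 = neighbour-≋-snoc {u1} {u0} (U.≃-sym {u0} {u1} s01) h10
      N2 : proj₁ u2 ≋ snoc w E2 h12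
      N2 = neighbour-≋-snoc {u1} {u2} s12 h12
      h23' : end (snoc w E2 h12) ≃ E3
      h23' = ≃-resp (≈-sym (end-snoc w E2 h12)) ≈-refl h23
      h03' : end (snoc w E0 h10) ≃ E3
      h03' = ≃-resp (≈-sym (end-snoc w E0 h10)) ≈-refl h03
      u₃≋u₀·E3 : (h : E0 ≃ E3) → proj₁ u3 ≋ snoc (proj₁ u0) E3 h
      u₃≋u₀·E3 h = ≋-trans (neighbour-≋-snoc {u2} {u3} s23 h23) (≋-trans (snoc-cong N2 E3 h23 h23')
                (≋-trans (≋-sym (snoc-square w E0 E2 E3 E3 h10 h03' h12 h23' (≃-sym h23) ≈-refl))
                  (≋-sym (snoc-cong N0 E3 h h03'))))
      Wv : (h : E0 ≃ E3) → UVert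
      Wv h = snoc (proj₁ u0) E3 h , ≈-trans (start-snoc (proj₁ u0) E3 h) (proj₂ u0)
      u₀≃u₃ : E0 ≃ E3 → u0 U.≃ u3
      u₀≃u₃ h@(inj₁ e) = inj₁ (≋-trans (≋-snoc-end (proj₁ u0) E3 h (≈-sym e)) (≋-sym (u₃≋u₀·E3 h)))
      u₀≃u₃ h@(inj₂ hh) = U.≃-resp {u0} {u0} {Wv h} {u3} ≋-refl (≋-sym (u₃≋u₀·E3 h))
                          (inj₂ (inj₁ (u0 , E3 , hh , ≋-refl , concat-edge-≋-snoc (proj₁ u0) hh)))

  proj-isCovering : IsCovering proj
  proj-isCovering = record { nbhd-injective = proj-nbhd-injective ; nbhd-surjective = proj-nbhd-surjective ; square = proj-square }

module Representability {ℓ} (X : Graph ℓ) (x₀ : Graph.V X) where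
  open Core X
  open CovCat X x₀
  open UniversalCover X x₀ using (UVert; Arrow; UC)
  module U = Graph UC

  basepoint : UVert
  basepoint = (0 , mkPath 0 (λ _ → x₀) (λ k ())) , ≈-refl

  module OnCover (Y : Cover) where
    module Y = Graph (Cover.G Y)
    module LY = Lifting X (Cover.G Y) (Cover.p Y) (Cover.isCovering Y)
    py = Cover.p Y

    fibre-start : ∀ {y} → fun py y ≈ x₀ → (a : UVert) → fun py y ≈ start (proj₁ a)
    fibre-start e a = ≈-trans e (≈-sym (proj₂ a))

    endLift-arrow : ∀ {y} (e : fun py y ≈ x₀) {a b} → Arrow a b →
                    LY.endLift (proj₁ a) y (fibre-start e a) Y.≃ LY.endLift (proj₁ b) y (fibre-start e b)
    endLift-arrow {y} e {a} {b} (c , v , hv , ac , ceb) =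
      Y.≃-resp (Y.sym (LY.endLift-≋ ac y (fibre-start e a) (fibre-start e c)))
               (Y.trans (LY.endLift-≋ (≋-sym (concat-edge-≋-snoc (proj₁ c) hv)) y
                          (fibre-start e (snoc (proj₁ c) v (inj₂ hv) , ≈-trans (start-snoc (proj₁ c) v (inj₂ hv)) (proj₂ c))) ec')
                        (LY.endLift-≋ ceb y ec' (fibre-start e b)))
               (LY.endLift-snoc (proj₁ c) v (inj₂ hv) y (fibre-start e c) _)
      where
        ec' : fun py y ≈ start (concat (proj₁ c) (edge hv) ≈-refl)
        ec' = ≈-trans (fibre-start e c) (≈-sym (start-concat (proj₁ c) (edge hv) ≈-refl))

    liftMor : Setoid.Carrier (Fib (Cover.over Y)) → Mor universal (Cover.over Y)
    liftMor (y , e) = record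
      { map = record
          { fun = λ a → LY.endLift (proj₁ a) y (fibre-start e a)
          ; cong = λ {a} {b} ab → LY.endLift-≋ ab y (fibre-start e a) (fibre-start e b)
          ; adj = λ { {a} {b} (inj₁ x) → endLift-arrow e {a} {b} x
                    ; {a} {b} (inj₂ x) → Y.≃-sym (endLift-arrow e {b} {a} x) } }
      ; comm = λ a → LY.proj-endLift (proj₁ a) y (fibre-start e a) }

    module Prefix (a : UVert) where
      open ≈-Reasoning
      w = proj₁ a
      n = len w
      prefix : ℕ → UVert
      prefix k = take k w , ≈-trans (≈-reflexive (at-0 w)) (proj₂ a)

      prefix-step : ∀ k → prefix k U.≃ prefix (suc k)
      prefix-step k with at-step w k
      ... | inj₁ e = inj₁ (≋-stretch (take k w) (take (suc k) w) (ℕP.n≤1+n k) pt)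
        where
          pt : ∀ j → j ≤ suc k → at (take (suc k) w) j ≈ at (take k w) j
          pt j le with ≤-suc-cases le
          ... | inj₁ j≤k = ≈-reflexive (P.trans (at-take (suc k) w j le) (P.sym (at-take k w j j≤k)))
          ... | inj₂ refl = begin
            at (take (suc k) w) (suc k)  ≡⟨ at-take (suc k) w (suc k) le ⟩
            at w (suc k)                 ≈⟨ e ⟨
            at w k                       ≈⟨ end-take k w ⟨
            end (take k w)               ≡⟨ at-≥len (take k w) (suc k) (ℕP.n≤1+n k) ⟨
            at (take k w) (suc k)        ∎
      ... | inj₂ h = inj₂ (inj₁ (prefix k , at w (suc k) , hv , ≋-refl ,
                       ≋-trans (concat-edge-≋-snoc (take k w) hv) (≋-pointwise≈ _ _ refl pt)))
        where
          hv : end (take k w) ∼ at w (suc k)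
          hv = ∼-resp (≈-sym (end-take k w)) ≈-refl h
          pt : ∀ j → j ≤ suc k → at (snoc (take k w) (at w (suc k)) (inj₂ hv)) j ≈ at (take (suc k) w) j
          pt j le with ≤-suc-cases le
          ... | inj₁ j≤k = ≈-reflexive (P.trans (at-snoc-≤ (take k w) _ (inj₂ hv) j j≤k)
                                        (P.trans (at-take k w j j≤k) (P.sym (at-take (suc k) w j le))))
          ... | inj₂ refl = ≈-reflexive (P.trans (at-snoc-top (take k w) _ (inj₂ hv)) (P.sym (at-take (suc k) w j le)))

      prefix-0 : prefix 0 U.≈ basepoint
      prefix-0 = ≋-pointwise≈ (take 0 w) (proj₁ basepoint) refl λ { .0 z≤n → ≈-trans (≈-reflexive (at-0 w)) (proj₂ a) }

      prefix-len : prefix n U.≈ a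
      prefix-len = ≋-pointwise≈ (take n w) w refl (λ j le → ≈-reflexive (at-take n w j le))

    -- The prefixes of a walk form a walk in the universal cover from the basepoint to its class,
    -- which f carries to a lift of the walk.
    mor-as-endLift : (f : Mor universal (Cover.over Y)) (a : UVert) (e : fun py (fun (map f) basepoint) ≈ start (proj₁ a))
        → LY.endLift (proj₁ a) (fun (map f) basepoint) e Y.≈ fun (map f) a
    mor-as-endLift f a e = Y.trans (Y.sym (LY.lift-characterisation (proj₁ a) (fun (map f) basepoint) e A sA pA
                                  (cong (map f) {prefix 0} {basepoint} prefix-0) n ℕP.≤-refl))
                        (cong (map f) {prefix n} {a} prefix-len)
      where
        open Prefix a
        A : ℕ → Y.V
        A k = fun (map f) (prefix k)
        sA : ∀ k → k < n → A k Y.≃ A (suc k)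
        sA k _ with prefix-step k
        ... | inj₁ e' = inj₁ (cong (map f) {prefix k} {prefix (suc k)} e')
        ... | inj₂ h = adj (map f) {prefix k} {prefix (suc k)} h
        pA : ∀ k → k ≤ n → fun py (A k) ≈ at w k
        pA k _ = ≈-trans (comm f (prefix k)) (end-take k w)

    homFib : Inverse (Hom universal (Cover.over Y)) (Fib (Cover.over Y))
    homFib = record
      { to = λ f → fun (map f) basepoint , comm f basepoint
      ; from = liftMor
      ; to-cong = λ fg → fg basepoint
      ; from-cong = λ {x} {x'} yy a → LY.endLift-cong (proj₁ a) (proj₁ x) (proj₁ x') (fibre-start (proj₂ x) a) (fibre-start (proj₂ x') a) yy
      ; inverse = (λ {x} {f} h → h basepoint) ,
                  (λ {f} {x} h a → Y.trans (LY.endLift-cong (proj₁ a) (proj₁ x) (fun (map f) basepoint) (fibre-start (proj₂ x) a)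
                                               (fibre-start (comm f basepoint) a) h)
                                           (mor-as-endLift f a (fibre-start (comm f basepoint) a))) }

  represents : Represents universal
  represents = (λ Y → OnCover.homFib Y) , λ {Y} {Y'} f g → Graph.refl (Cover.G Y')

module Monodromy {ℓ} (X : Graph ℓ) (x₀ : Graph.V X) where
  open Core X
  open CovCat X x₀
  open UniversalCover X x₀ using (UC; proj)
  open UniversalCoverIsCovering X x₀ using (proj-isCovering)
  open Representability X x₀ using (basepoint; module OnCover)

  module Transport (Y : Cover) where
    module Y = Graph (Cover.G Y)
    module LY = Lifting X (Cover.G Y) (Cover.p Y) (Cover.isCovering Y)
    open Setoid (Fib (Cover.over Y)) public using () renaming (Carrier to FibY; _≈_ to _≈F_)
    open import Relation.Binary.Reasoning.Setoid (Fib (Cover.over Y))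
      using (begin_; _∎; step-≈-⟩; step-≈-⟨)

    fibre-start : (g : Loop X x₀) → ∀ {y} → fun (Cover.p Y) y ≈ x₀ → fun (Cover.p Y) y ≈ start (proj₁ g)
    fibre-start g e = ≈-trans e (≈-sym (proj₁ (proj₂ g)))

    fibre-start-reverse : (g : Loop X x₀) → ∀ {y} → fun (Cover.p Y) y ≈ x₀ → fun (Cover.p Y) y ≈ start (reverse (proj₁ g))
    fibre-start-reverse g e = ≈-trans e (≈-trans (≈-sym (proj₂ (proj₂ g))) (≈-sym (start-reverse (proj₁ g))))

    transport : Loop X x₀ → FibY → FibY
    transport g (y , e) = LY.endLift (proj₁ g) y (fibre-start g e) ,
                          ≈-trans (LY.proj-endLift (proj₁ g) y (fibre-start g e)) (proj₂ (proj₂ g))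

    transportBack : Loop X x₀ → FibY → FibY
    transportBack g (y , e) = LY.endLift (reverse (proj₁ g)) y (fibre-start-reverse g e) ,
      ≈-trans (LY.proj-endLift (reverse (proj₁ g)) y (fibre-start-reverse g e)) (≈-trans (end-reverse (proj₁ g)) (proj₁ (proj₂ g)))

    transport-cong : ∀ g {a b} → a ≈F b → transport g a ≈F transport g b
    transport-cong g {a} {b} ab = LY.endLift-cong (proj₁ g) (proj₁ a) (proj₁ b) _ _ ab

    transportBack-cong : ∀ g {a b} → a ≈F b → transportBack g a ≈F transportBack g b
    transportBack-cong g {a} {b} ab = LY.endLift-cong (reverse (proj₁ g)) (proj₁ a) (proj₁ b) _ _ ab

    transportBack-transport : ∀ g a → transportBack g (transport g a) ≈F a
    transportBack-transport g (y , e) = LY.endLift-reverse (proj₁ g) y (fibre-start g e) _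

    transport-transportBack : ∀ g a → transport g (transportBack g a) ≈F a
    transport-transportBack g (y , e) = LY.endLift-reverse′ (proj₁ g) y (fibre-start-reverse g e) _

    transport-≋ : ∀ {g h : Loop X x₀} → proj₁ g ≋ proj₁ h → ∀ a → transport g a ≈F transport h a
    transport-≋ p (y , e) = LY.endLift-≋ p y _ _

    transport-injective : ∀ {g h : Loop X x₀} → (∀ a → transportBack g a ≈F transportBack h a) →
                          ∀ a → transport g a ≈F transport h a
    transport-injective {g} {h} H a = begin
      transport g a                                  ≈⟨ transport-cong g {a = transportBack h (transport h a)} (transportBack-transport h a) ⟨
      transport g (transportBack h (transport h a))  ≈⟨ transport-cong g (H (transport h a)) ⟨
      transport g (transportBack g (transport h a))  ≈⟨ transport-transportBack g (transport h a) ⟩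
      transport h a                                  ∎

    monodromy : Loop X x₀ → Inverse (Fib (Cover.over Y)) (Fib (Cover.over Y))
    monodromy g = record
      { to = transportBack g ; from = transport g ; to-cong = transportBack-cong g ; from-cong = transport-cong g
      ; inverse = (λ {x} {y} h → Y.trans (transportBack-cong g {y} {transport g x} h) (transportBack-transport g x)) ,
                  (λ {x} {y} h → Y.trans (transport-cong g {y} {transportBack g x} h) (transport-transportBack g x)) }

  endLift-natural : ∀ (Y Y' : Cover) (f : Mor (Cover.over Y) (Cover.over Y')) w y e e'
           → Graph._≈_ (Cover.G Y') (Lifting.endLift X (Cover.G Y') (Cover.p Y') (Cover.isCovering Y') w (fun (map f) y) e')
                                    (fun (map f) (Lifting.endLift X (Cover.G Y) (Cover.p Y) (Cover.isCovering Y) w y e))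
  endLift-natural Y Y' f w y e e' = Y'.sym (L'.lift-characterisation w (fun (map f) y) e' A sA pA Y'.refl (len w) ℕP.≤-refl)
    where
      module Y' = Graph (Cover.G Y')
      module L = Lifting X (Cover.G Y) (Cover.p Y) (Cover.isCovering Y)
      module L' = Lifting X (Cover.G Y') (Cover.p Y') (Cover.isCovering Y')
      A : ℕ → Y'.V
      A k = fun (map f) (L.lift w y e k)
      sA : ∀ k → k < len w → A k Y'.≃ A (suc k)
      sA k _ with L.lift-step w y e k
      ... | inj₁ q = inj₁ (cong (map f) q)
      ... | inj₂ h = adj (map f) h
      pA : ∀ k → k ≤ len w → fun (Cover.p Y') (A k) ≈ at w k
      pA k _ = ≈-trans (comm f (L.lift w y e k)) (L.lift-proj w y e k)

  -- Transport along walks is a right action; acting by the reversed loop makes φ a homomorphism for α ·A β = α ∘ β.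
  φ : Loop X x₀ → FibAut
  φ g = record
    { component = λ Y → Transport.monodromy Y g
    ; natural = λ {Y} {Y'} f y →
        endLift-natural Y Y' f (reverse (proj₁ g)) (proj₁ y) (Transport.fibre-start-reverse Y g (proj₂ y)) _ }

  universalCover : Cover
  universalCover = record { G = UC ; p = proj ; isCovering = proj-isCovering }

  idUniversal : Mor universal (Cover.over universalCover)
  idUniversal = record { map = record { fun = λ a → a ; cong = λ e → e ; adj = inj₂ } ; comm = λ a → ≈-refl }

  φ-cong : ∀ {g h : Loop X x₀} → proj₁ g ≋ proj₁ h → ∀ (Y : Cover) a →
           Transport._≈F_ Y (Transport.transportBack Y g a) (Transport.transportBack Y h a)
  φ-cong {g} {h} p Y a = Y.sym (Y.trans (transportBack-cong h {a} {transport h b} a≈) (transportBack-transport h b))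
    where
      open Transport Y
      b = transportBack g a
      a≈ : a ≈F transport h b
      a≈ = Y.trans (Y.sym (transport-transportBack g a)) (transport-≋ {g} {h} p b)

  φ-homo : ∀ (g h : Loop X x₀) (Y : Cover) a →
           Transport._≈F_ Y (Transport.transportBack Y (_·L_ X x₀ g h) a)
                            (Transport.transportBack Y g (Transport.transportBack Y h a))
  φ-homo g@(wg@(ng , γ) , s , t) h@(wh@(nh , δ) , s' , t') Y (y , e) =
    LY.endLift-concat c (reverse wh) (reverse wg) y _ _ _ (ℕP.+-comm ng nh) pt₁ pt₂
    where
      open Transport Y
      open ≈-Reasoning
      j = ≈-trans t (≈-sym s')
      gh = concat wg wh j
      c = reverse gh
      pt₁ : ∀ i → i ≤ nh → at c i ≈ at (reverse wh) i
      pt₁ i le = begin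
        at c i                   ≡⟨ at-reverse gh i (ℕP.≤-trans le (ℕP.m≤n+m nh ng)) ⟩
        at gh (ng + nh ∸ i)      ≡⟨ P.cong (at gh) (ℕP.+-∸-assoc ng le) ⟩
        at gh (ng + (nh ∸ i))    ≈⟨ at-concat-≥ wg wh j (ng + (nh ∸ i)) (ℕP.m≤m+n ng _) (ℕP.+-monoʳ-≤ ng (ℕP.m∸n≤m nh i)) ⟩
        at wh (ng + (nh ∸ i) ∸ ng) ≡⟨ P.cong (at wh) (ℕP.m+n∸m≡n ng (nh ∸ i)) ⟩
        at wh (nh ∸ i)           ≡⟨ at-reverse wh i le ⟨
        at (reverse wh) i        ∎
      pt₂ : ∀ i → i ≤ ng → at c (nh + i) ≈ at (reverse wg) i
      pt₂ i le = begin
        at c (nh + i)            ≡⟨ at-reverse gh (nh + i) (P.subst (nh + i ≤_) (ℕP.+-comm nh ng) (ℕP.+-monoʳ-≤ nh le)) ⟩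
        at gh (ng + nh ∸ (nh + i)) ≡⟨ P.cong (λ k → at gh (k ∸ (nh + i))) (ℕP.+-comm ng nh) ⟩
        at gh (nh + ng ∸ (nh + i)) ≡⟨ P.cong (at gh) (ℕP.[m+n]∸[m+o]≡n∸o nh ng i) ⟩
        at gh (ng ∸ i)           ≈⟨ at-concat-≤ wg wh j (ng ∸ i) (ℕP.m∸n≤m ng i) ⟩
        at wg (ng ∸ i)           ≡⟨ at-reverse wg i le ⟨
        at (reverse wg) i        ∎

  -- In the universal cover, transporting the basepoint along a loop yields the class of the loop.
  φ-injective : ∀ {g h : Loop X x₀} → (∀ (Y : Cover) a → Transport._≈F_ Y (Transport.transportBack Y g a) (Transport.transportBack Y h a)) →
                proj₁ g ≋ proj₁ h
  φ-injective {g} {h} H =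
    ≋-trans (≋-sym (OnCover.mor-as-endLift universalCover idUniversal (proj₁ g , proj₁ (proj₂ g)) _))
      (≋-trans (Transport.transport-injective universalCover {g} {h} (H universalCover) (basepoint , ≈-refl))
               (OnCover.mor-as-endLift universalCover idUniversal (proj₁ h , proj₁ (proj₂ h)) _))

  -- By naturality, α is determined by α applied to the basepoint of the universal cover.
  φ-surjective : ∀ (α : FibAut) → Σ (Loop X x₀) λ g → ∀ {z : Loop X x₀} → proj₁ z ≋ proj₁ g → ∀ (Y : Cover) a →
                 Transport._≈F_ Y (Transport.transportBack Y z a) (Inverse.to (FibAut.component α Y) a)
  φ-surjective α = g , λ {z} z≋g Y a → Graph.trans (Cover.G Y) (φ-cong {z} {g} z≋g Y a) (φg≈α Y a)
    where
      δF = Inverse.to (FibAut.component α universalCover) (basepoint , ≈-refl)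
      δ = proj₁ δF
      wδ = proj₁ δ
      g : Loop X x₀
      g = reverse wδ , ≈-trans (start-reverse wδ) (proj₂ δF) , ≈-trans (end-reverse wδ) (proj₂ δ)
      φg≈α : ∀ (Y : Cover) a → Transport._≈F_ Y (Transport.transportBack Y g a) (Inverse.to (FibAut.component α Y) a)
      φg≈α Y (y , e) =
        Y.trans (LY.endLift-pointwise (reverse (reverse wδ)) wδ y y _ (OnCover.fibre-start Y e δ) refl (at-reverse-reverse wδ) Y.refl)
          (Y.sym (Y.trans (Inverse.to-cong (FibAut.component α Y) {y , e} {Func.to (fibMap f) (basepoint , ≈-refl)} Y.refl)
                          (FibAut.natural α {universalCover} {Y} f (basepoint , ≈-refl))))
        where
          open Transport Y
          f = OnCover.liftMor Y (y , e)

  φ-isMagmaIsomorphism : MagmaMorphisms.IsMagmaIsomorphism (A₁ X x₀) AutFib φ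
  φ-isMagmaIsomorphism = record
    { isMagmaMonomorphism = record
        { isMagmaHomomorphism = record
            { isRelHomomorphism = record { cong = λ {g} {h} → φ-cong {g} {h} }
            ; homo = φ-homo }
        ; injective = λ {g} {h} → φ-injective {g} {h} }
    ; surjective = φ-surjective }

proposition4p32 : ∀ {ℓ} (X : Graph ℓ) (x₀ : Graph.V X) →
    Σ (IsCovering (UniversalCover.proj X x₀)) (λ _ →
    CovCat.Represents X x₀ (CovCat.universal X x₀))
    ×
    Σ (Loop X x₀ → CovCat.FibAut X x₀) (λ φ →
    MagmaMorphisms.IsMagmaIsomorphism (A₁ X x₀) (CovCat.AutFib X x₀) φ)
proposition4p32 X x₀ =
  (UniversalCoverIsCovering.proj-isCovering X x₀ , Representability.represents X x₀) ,
  (Monodromy.φ X x₀ , Monodromy.φ-isMagmaIsomorphism X x₀)
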